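{- Let $K$ be a real quadratic field and let $x\in\mathcal{O}_K$ satisfy $N(x)^2\le\Delta_K/3$. Let $\mathcal{J}=(x)$. If $\sigma(\mathcal{J})=\mathcal{J}$, then $x$ extends to at most one good basis of $\mathcal{O}_K$ up to equivalence; i.e. all good bases of $\mathcal{O}_K$ of the form $\{x,y\}$, $y\in\mathcal{O}_K$, are equivalent to one another.
   Context: $K=\mathbb{Q}(\sqrt D)\subset\mathbb{R}$, $D>1$ square-free; $\sigma$ is the nontrivial automorphism, $\bar x=\sigma(x)$, $N(x)=x\bar x$, $\Delta_K$ the discriminant. $\psi(x)=(x,\bar x)$, $\Lambda_K=\psi(\mathcal{O}_K)$, $T_\alpha=\mathrm{diag}(\alpha,1/\alpha)$. A basis $\{u,v\}$ of a planar lattice is minimal if $\|u\|=\|v\|$ and $|\langle u,v\rangle|\le\frac12\|u\|\|v\|$. A $\mathbb{Z}$-basis $\{x,y\}$ of $\mathcal{O}_K$ is good if for some $\alpha>0$, $T_\alpha\Lambda_K$ is well-rounded with minimal basis $\{T_\alpha\psi(x),T_\alpha\psi(y)\}$. Bases $\{x,y\},\{x',y'\}$ are equivalent if $F(x,y)=F(x',y')$, where $F(x,y)=N(x)^2+N(x)N(y)+N(y)^2-\Delta_K/4$. -}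

module Defs where

open import Data.Nat as ℕ using (ℕ; _%_)
open import Data.Nat.Primality using (Prime)
open import Data.Nat.Divisibility using (_∣_)
open import Data.Integer as ℤ using (ℤ; +_)
open import Data.Rational as ℚ using (ℚ; 0ℚ; 1ℚ; ½; _/_)
open import Data.Product using (_×_; _,_; Σ; ∃; ∃-syntax; proj₁; proj₂)
open import Data.Sum using (_⊎_)
open import Relation.Binary.PropositionalEquality using (_≡_)
open import Relation.Nullary using (¬_)

SquareFree : ℕ → Set
SquareFree D = ∀ p → Prime p → ¬ (p ℕ.* p ∣ D)

-- The real quadratic field K = ℚ(√D), D > 1 square-free (D is a parameter).
-- An element a + b√D is represented by the pair (a , b) of rationals.

K : Set
K = ℚ × ℚ

module QF (D : ℕ) where

  Dℚ : ℚ
  Dℚ = (+ D) / 1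

  emb : ℚ → K
  emb q = (q , 0ℚ)

  0K 1K : K
  0K = emb 0ℚ
  1K = emb 1ℚ

  _+K_ : K → K → K
  (a , b) +K (c , d) = (a ℚ.+ c , b ℚ.+ d)

  -K_ : K → K
  -K (a , b) = (ℚ.- a , ℚ.- b)

  _-K_ : K → K → K
  x -K y = x +K (-K y)

  _*K_ : K → K → K
  (a , b) *K (c , d) = (a ℚ.* c ℚ.+ Dℚ ℚ.* (b ℚ.* d) , a ℚ.* d ℚ.+ b ℚ.* c)

  σ : K → K
  σ (a , b) = (a , ℚ.- b)

  N : K → ℚ
  N (a , b) = a ℚ.* a ℚ.- Dℚ ℚ.* (b ℚ.* b)

  -- Order on K induced by the real embedding K ⊂ ℝ with √D > 0:
  -- a + b√D > 0 in ℝ.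
  PosK : K → Set
  PosK (a , b) =
      (ℚ.Positive a × ℚ.NonNegative b)
    ⊎ (ℚ.NonNegative a × ℚ.Positive b)
    ⊎ (ℚ.Positive a × ℚ.Negative b × (Dℚ ℚ.* (b ℚ.* b) ℚ.< a ℚ.* a))
    ⊎ (ℚ.Negative a × ℚ.Positive b × (a ℚ.* a ℚ.< Dℚ ℚ.* (b ℚ.* b)))

  _<K_ : K → K → Set
  x <K y = PosK (y -K x)

  _≤K_ : K → K → Set
  x ≤K y = (x ≡ y) ⊎ (x <K y)

  ω : K
  ω with D % 4
  ... | 1 = (½ , ½)
  ... | _ = (0ℚ , 1ℚ)

  Δ : ℚ
  Δ with D % 4
  ... | 1 = Dℚ
  ... | _ = (+ 4) / 1 ℚ.* Dℚ

  intK : ℤ → K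
  intK m = emb (m / 1)

  lin : ℤ → K → ℤ → K → K
  lin m x n y = (intK m *K x) +K (intK n *K y)

  InO : K → Set
  InO z = ∃[ m ] ∃[ n ] z ≡ lin m 1K n ω

  O : Set
  O = Σ K InO

  IsZBasis : K → K → Set
  IsZBasis x y =
      (∀ (z : O) → ∃[ m ] ∃[ n ] proj₁ z ≡ lin m x n y)
    × (∀ m n m' n' → lin m x n y ≡ lin m' x n' y → (m ≡ m') × (n ≡ n'))

  -- For α > 0 put s = α⁴.  With
  --   ‖T_α ψ(z)‖² = α² z² + σ(z)²/α²,  ⟨T_α ψ(x), T_α ψ(y)⟩ = α² x y + σ(x)σ(y)/α²,
  -- multiplying by α² > 0, the minimal-basis conditions
  --   ‖u‖ = ‖v‖,  |⟨u,v⟩| ≤ ½ ‖u‖‖v‖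
  -- become the conditions below on s.  Since x² ≠ y² for a basis, such an s
  -- is forced to lie in K, so quantifying s over positive elements of K is
  -- the same as quantifying α over positive reals.
  sqN : K → K → K
  sqN s z = (s *K (z *K z)) +K (σ z *K σ z)

  ip : K → K → K → K
  ip s x y = (s *K (x *K y)) +K (σ x *K σ y)

  two : K
  two = emb ((+ 2) / 1)

  GoodCond : K → K → K → Set
  GoodCond s x y =
      sqN s x ≡ sqN s y
    × ((-K sqN s x) ≤K (two *K ip s x y))
    × ((two *K ip s x y) ≤K sqN s x)

  IsGood : K → K → Set
  IsGood x y = InO x × InO y × IsZBasis x y × ∃[ s ] (0K <K s × GoodCond s x y)

  F : K → K → ℚ
  F x y = N x ℚ.* N x ℚ.+ N x ℚ.* N y ℚ.+ N y ℚ.* N y ℚ.- Δ ℚ.* ((+ 1) / 4)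

  InPrincipal : K → K → Set
  InPrincipal x z = InO z × ∃[ r ] (InO r × z ≡ x *K r)

  InσPrincipal : K → K → Set
  InσPrincipal x z = ∃[ j ] (InPrincipal x j × z ≡ σ j)

module Submission where

-- Write a = N(x).  As σ(x) generates the ideal (x), σ(x) = x r with N(r) = 1, and then for every
-- ℤ-basis {x, y} of O_K the trace T = x σ(y) + σ(x) y is an integer multiple k a; a second basis
-- {x, y′} has y′ = m x ± y, so its multiplier 2m ± k has the parity of k.  The discriminant gives
-- T² = Δ + 4 a N(y), and goodness gives 4 (a + N(y))² ≤ T², because the Gram entries L = ‖u‖² and
-- c = ⟨u, v⟩ satisfy c T = L (N(x) + N(y)) and |2c| ≤ L.  With A = a² and S = Δ − 3A these say that
-- S lies in the window [(|k| − 1)² A, (|k| + 1)² A] and that 16 A N(y) (a + N(y)) = (k² A − S − A)² − 4A².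
-- Windows of two integers of equal parity meet at most in a common endpoint, where k² A − S − A only
-- changes sign; so N(y) (a + N(y)), and with it F(x, y), does not depend on y.

open import Defs
open import Algebra.Solver.Ring.AlmostCommutativeRing
  using (AlmostCommutativeRing; _-Raw-AlmostCommutative⟶_)
import Algebra.Solver.Ring
open import Algebra.Structures.Biased using (isCommutativeMonoidˡ; isCommutativeSemiringˡ)
open import Data.Empty using (⊥-elim)
open import Data.Integer as ℤ using (ℤ; +_; +[1+_]; -[1+_]; -1ℤ)
import Data.Integer.Properties as ℤP
import Data.Integer.Tactic.RingSolver as ℤ-Solver
open import Data.List using ([]; _∷_)
open import Data.List.Relation.Unary.All using (_∷_)
import Data.Maybe as Maybe
open import Data.Nat as ℕ using (ℕ; zero; suc; _<_; z≤n; s≤s)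
import Data.Nat.Coprimality as Coprimality
open import Data.Nat.Divisibility using (_∣_; divides; ∣-trans; m∣m*n; n∣m*n)
import Data.Nat.DivMod as ℕDM
open import Data.Nat.Induction using (<-rec)
open import Data.Nat.ListAction using (product)
open import Data.Nat.Primality using (Prime; euclidsLemma; prime⇒nonZero; prime⇒nonTrivial)
open import Data.Nat.Primality.Factorisation using (factorise)
import Data.Nat.Properties as ℕP
open import Data.Nat.Solver using (module +-*-Solver)
open import Data.Product using (_×_; _,_; proj₁; proj₂; ∃-syntax)
open import Data.Rational as ℚ using (ℚ; mkℚ; 0ℚ; 1ℚ; ½; _/_; ↥_; _+_; _*_; _-_; -_; _≤_)
import Data.Rational.Properties as ℚP
import Data.Rational.Solver as ℚSolver
import Data.Rational.Unnormalised.Properties as ℚᵘP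
open import Data.Sum using (_⊎_; inj₁; inj₂; [_,_]′)
open import Function using (_∘_)
open import Relation.Binary.Definitions using (Tri; tri<; tri≈; tri>)
open import Relation.Binary.PropositionalEquality
open import Relation.Nullary using (¬_; Dec; yes; no)
open import Relation.Nullary.Decidable using (dec⇒maybe)
open import Tactic.RingSolver using (solve-∀)
open import Tactic.RingSolver.Core.AlmostCommutativeRing using (fromCommutativeRing)
  renaming (AlmostCommutativeRing to TacticRing)

fromℤ : ℤ → ℚ
fromℤ i = i / 1

fromℕ : ℕ → ℚ
fromℕ n = fromℤ (+ n)

2ℚ 3ℚ 4ℚ 16ℚ : ℚ
2ℚ = fromℕ 2
3ℚ = fromℕ 3
4ℚ = fromℕ 4
16ℚ = fromℕ 16

mkℚ/1 : ℤ → ℚ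
mkℚ/1 i = mkℚ i 0 (Coprimality.sym (Coprimality.1-coprimeTo ℤ.∣ i ∣))

fromℤ≡mkℚ/1 : ∀ i → fromℤ i ≡ mkℚ/1 i
fromℤ≡mkℚ/1 i = ℚP.↥p/↧p≡p (mkℚ/1 i)

fromℤ-injective : ∀ {i j} → fromℤ i ≡ fromℤ j → i ≡ j
fromℤ-injective {i} {j} eq = begin
  i            ≡⟨ cong ↥_ (fromℤ≡mkℚ/1 i) ⟨
  ↥ (fromℤ i)  ≡⟨ cong ↥_ eq ⟩
  ↥ (fromℤ j)  ≡⟨ cong ↥_ (fromℤ≡mkℚ/1 j) ⟩
  j            ∎
  where open ≡-Reasoning

fromℤ-+ : ∀ i j → fromℤ (i ℤ.+ j) ≡ fromℤ i + fromℤ j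
fromℤ-+ i j = begin
  (i ℤ.+ j) / 1                  ≡⟨ cong (_/ 1) (cong₂ ℤ._+_ (ℤP.*-identityʳ i) (ℤP.*-identityʳ j)) ⟨
  (i ℤ.* + 1 ℤ.+ j ℤ.* + 1) / 1  ≡⟨ cong₂ _+_ (fromℤ≡mkℚ/1 i) (fromℤ≡mkℚ/1 j) ⟨
  fromℤ i + fromℤ j              ∎
  where open ≡-Reasoning

fromℤ-* : ∀ i j → fromℤ (i ℤ.* j) ≡ fromℤ i * fromℤ j
fromℤ-* i j = sym (cong₂ _*_ (fromℤ≡mkℚ/1 i) (fromℤ≡mkℚ/1 j))

fromℤ-neg : ∀ i → fromℤ (ℤ.- i) ≡ - fromℤ i
fromℤ-neg i = trans (fromℤ≡mkℚ/1 (ℤ.- i)) (trans (neg-mkℚ i) (cong -_ (sym (fromℤ≡mkℚ/1 i))))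
  where
  neg-mkℚ : ∀ i → mkℚ/1 (ℤ.- i) ≡ - mkℚ/1 i
  neg-mkℚ (+ zero) = refl
  neg-mkℚ +[1+ n ] = refl
  neg-mkℚ -[1+ n ] = refl

fromℕ-+ : ∀ m n → fromℕ (m ℕ.+ n) ≡ fromℕ m + fromℕ n
fromℕ-+ m n = trans (cong fromℤ (ℤP.pos-+ m n)) (fromℤ-+ (+ m) (+ n))

fromℕ-* : ∀ m n → fromℕ (m ℕ.* n) ≡ fromℕ m * fromℕ n
fromℕ-* m n = trans (cong fromℤ (ℤP.pos-* m n)) (fromℤ-* (+ m) (+ n))

ℚ-ring : TacticRing _ _
ℚ-ring = fromCommutativeRing ℚP.+-*-commutativeRing (λ p → dec⇒maybe (0ℚ ℚP.≟ p))

neg-involutive : ∀ p → - (- p) ≡ p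
neg-involutive = solve-∀ ℚ-ring

neg-square : ∀ p → - p * - p ≡ p * p
neg-square = solve-∀ ℚ-ring

p-q+q≡p : ∀ p q → p - q + q ≡ p
p-q+q≡p = solve-∀ ℚ-ring

p-q≡0⇒p≡q : ∀ {p q} → p - q ≡ 0ℚ → p ≡ q
p-q≡0⇒p≡q {p} {q} p-q≡0 = trans (sym (p-q+q≡p p q)) (trans (cong (_+ q) p-q≡0) (ℚP.+-identityˡ q))

p*q≡0⇒p≡0∨q≡0 : ∀ p q → p * q ≡ 0ℚ → p ≡ 0ℚ ⊎ q ≡ 0ℚ
p*q≡0⇒p≡0∨q≡0 p q pq≡0 with p ℚP.≟ 0ℚ
... | yes p≡0 = inj₁ p≡0
... | no  p≢0 = inj₂ (begin
  q                 ≡⟨ ℚP.*-identityˡ q ⟨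
  1ℚ * q            ≡⟨ cong (_* q) (ℚP.*-inverseˡ p) ⟨
  ℚ.1/ p * p * q    ≡⟨ ℚP.*-assoc (ℚ.1/ p) p q ⟩
  ℚ.1/ p * (p * q)  ≡⟨ cong (ℚ.1/ p *_) pq≡0 ⟩
  ℚ.1/ p * 0ℚ       ≡⟨ ℚP.*-zeroʳ (ℚ.1/ p) ⟩
  0ℚ                ∎)
  where
  open ≡-Reasoning
  instance
    p-nonZero : ℚ.NonZero p
    p-nonZero = ℚ.≢-nonZero p≢0

*-cancelˡ-≢0 : ∀ c {p q} → c ≢ 0ℚ → c * p ≡ c * q → p ≡ q
*-cancelˡ-≢0 c {p} {q} c≢0 cp≡cq =
  [ (λ c≡0 → ⊥-elim (c≢0 c≡0)) , p-q≡0⇒p≡q ]′ (p*q≡0⇒p≡0∨q≡0 c (p - q) (begin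
  c * (p - q)    ≡⟨ distrib c p q ⟩
  c * p - c * q  ≡⟨ cong (_- c * q) cp≡cq ⟩
  c * q - c * q  ≡⟨ ℚP.+-inverseʳ (c * q) ⟩
  0ℚ             ∎))
  where
  open ≡-Reasoning
  distrib : ∀ c p q → c * (p - q) ≡ c * p - c * q
  distrib = solve-∀ ℚ-ring

pos⇒¬pos-neg : ∀ p → ℚ.Positive p → ¬ ℚ.Positive (- p)
pos⇒¬pos-neg (mkℚ +[1+ _ ] _ _) _ ()

pos⇒¬nonNeg-neg : ∀ p → ℚ.Positive p → ¬ ℚ.NonNegative (- p)
pos⇒¬nonNeg-neg (mkℚ +[1+ _ ] _ _) _ ()

nonNeg⇒¬pos-neg : ∀ p → ℚ.NonNegative p → ¬ ℚ.Positive (- p)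
nonNeg⇒¬pos-neg (mkℚ (+ zero) _ _) _ ()
nonNeg⇒¬pos-neg (mkℚ +[1+ _ ] _ _) _ ()

neg⇒¬neg-neg : ∀ p → ℚ.Negative p → ¬ ℚ.Negative (- p)
neg⇒¬neg-neg (mkℚ -[1+ _ ] _ _) _ ()

*-pos : ∀ {p q} → 0ℚ ℚ.< p → 0ℚ ℚ.< q → 0ℚ ℚ.< p * q
*-pos {p} {q} 0<p 0<q = ℚP.positive⁻¹ (p * q) {{ℚP.pos*pos⇒pos p {{ℚ.positive 0<p}} q {{ℚ.positive 0<q}}}}

neg*neg>0 : ∀ {p q} → p ℚ.< 0ℚ → q ℚ.< 0ℚ → 0ℚ ℚ.< p * q
neg*neg>0 {p} {q} p<0 q<0 = ℚP.positive⁻¹ (p * q) {{ℚP.neg*neg⇒pos p {{ℚ.negative p<0}} q {{ℚ.negative q<0}}}}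

neg*pos<0 : ∀ {p q} → p ℚ.< 0ℚ → 0ℚ ℚ.< q → p * q ℚ.< 0ℚ
neg*pos<0 {p} {q} p<0 0<q = ℚP.negative⁻¹ (p * q) {{ℚP.neg*pos⇒neg p {{ℚ.negative p<0}} q {{ℚ.positive 0<q}}}}

pos*neg<0 : ∀ {p q} → 0ℚ ℚ.< p → q ℚ.< 0ℚ → p * q ℚ.< 0ℚ
pos*neg<0 {p} {q} 0<p q<0 = ℚP.negative⁻¹ (p * q) {{ℚP.pos*neg⇒neg p {{ℚ.positive 0<p}} q {{ℚ.negative q<0}}}}

*-nonNeg : ∀ {p q} → 0ℚ ≤ p → 0ℚ ≤ q → 0ℚ ≤ p * q
*-nonNeg {p} {q} 0≤p 0≤q = ℚP.nonNegative⁻¹ (p * q) {{ℚP.nonNeg*nonNeg⇒nonNeg p {{ℚ.nonNegative 0≤p}} q {{ℚ.nonNegative 0≤q}}}}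

+-pos-nonNeg : ∀ {p q} → 0ℚ ℚ.< p → 0ℚ ≤ q → 0ℚ ℚ.< p + q
+-pos-nonNeg {p} {q} 0<p 0≤q = ℚP.+-mono-<-≤ 0<p 0≤q

+-nonNeg : ∀ {p q} → 0ℚ ≤ p → 0ℚ ≤ q → 0ℚ ≤ p + q
+-nonNeg {p} {q} 0≤p 0≤q = ℚP.+-mono-≤ 0≤p 0≤q

fromℕ-nonNeg : ∀ n → 0ℚ ≤ fromℕ n
fromℕ-nonNeg n = ℚP.nonNegative⁻¹ (fromℕ n) {{ℚP.normalize-nonNeg n 1}}

square-pos : ∀ p → p ≢ 0ℚ → 0ℚ ℚ.< p * p
square-pos p p≢0 with ℚP.<-cmp p 0ℚ
... | tri< p<0 _ _ = neg*neg>0 p<0 p<0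
... | tri≈ _ p≡0 _ = ⊥-elim (p≢0 p≡0)
... | tri> _ _ 0<p = *-pos 0<p 0<p

square-nonNeg : ∀ p → 0ℚ ≤ p * p
square-nonNeg p with p ℚP.≟ 0ℚ
... | yes refl = ℚP.≤-refl
... | no  p≢0  = ℚP.<⇒≤ (square-pos p p≢0)

p<q⇒0<q-p : ∀ {p q} → p ℚ.< q → 0ℚ ℚ.< q - p
p<q⇒0<q-p {p} {q} p<q = subst (ℚ._< q - p) (ℚP.+-inverseʳ p) (ℚP.+-monoˡ-< (- p) p<q)

p<q⇒p-q<0 : ∀ {p q} → p ℚ.< q → p - q ℚ.< 0ℚ
p<q⇒p-q<0 {p} {q} p<q = subst (p - q ℚ.<_) (ℚP.+-inverseʳ q) (ℚP.+-monoˡ-< (- q) p<q)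

p≤q⇒0≤q-p : ∀ {p q} → p ≤ q → 0ℚ ≤ q - p
p≤q⇒0≤q-p {p} {q} p≤q = subst (ℚ._≤ q - p) (ℚP.+-inverseʳ p) (ℚP.+-monoˡ-≤ (- p) p≤q)

0≤p-q⇒q≤p : ∀ {p q} → 0ℚ ≤ p - q → q ≤ p
0≤p-q⇒q≤p {p} {q} 0≤p-q = subst₂ _≤_ (ℚP.+-identityˡ q) (p-q+q≡p p q) (ℚP.+-monoˡ-≤ q 0≤p-q)

0<p-q⇒q<p : ∀ {p q} → 0ℚ ℚ.< p - q → q ℚ.< p
0<p-q⇒q<p {p} {q} 0<p-q = subst₂ ℚ._<_ (ℚP.+-identityˡ q) (p-q+q≡p p q) (ℚP.+-monoˡ-< q 0<p-q)

square-bound : ∀ t u → t ≢ 0ℚ → 0ℚ ≤ (t * (t - 2ℚ * u)) * (t * (t + 2ℚ * u)) →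
               4ℚ * (u * u) ≤ t * t
square-bound t u t≢0 0≤product = 0≤p-q⇒q≤p (ℚP.*-cancelˡ-≤-pos (t * t) {{ℚ.positive (square-pos t t≢0)}}
  (subst₂ _≤_ (sym (ℚP.*-zeroʳ (t * t))) (factor t u) 0≤product))
  where
  factor : ∀ t u → (t * (t - 2ℚ * u)) * (t * (t + 2ℚ * u))
                 ≡ (t * t) * (t * t - 4ℚ * (u * u))
  factor = solve-∀ ℚ-ring

Unitℤ : ℤ → Set
Unitℤ i = i ≡ + 1 ⊎ i ≡ -1ℤ

unit*unit≡1 : ∀ {i} → Unitℤ i → i ℤ.* i ≡ + 1
unit*unit≡1 (inj₁ refl) = refl
unit*unit≡1 (inj₂ refl) = refl

i*j≡1⇒unit : ∀ i j → i ℤ.* j ≡ + 1 → Unitℤ i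
i*j≡1⇒unit i j ij≡1 with ℕP.m*n≡1⇒m≡1 ℤ.∣ i ∣ ℤ.∣ j ∣ (trans (sym (ℤP.abs-* i j)) (cong ℤ.∣_∣ ij≡1))
i*j≡1⇒unit (+ .1)    _ _ | refl = inj₁ refl
i*j≡1⇒unit -[1+ 0 ]  _ _ | refl = inj₂ refl

2*i≢1 : ∀ i → + 2 ℤ.* i ≢ + 1
2*i≢1 i 2i≡1 with ℕP.m*n≡1⇒m≡1 2 ℤ.∣ i ∣ (trans (sym (ℤP.abs-* (+ 2) i)) (cong ℤ.∣_∣ 2i≡1))
... | ()

abs-parity : ∀ i → ∃[ e ] + ℤ.∣ i ∣ ≡ i ℤ.+ + 2 ℤ.* e
abs-parity (+ n) = + 0 , sym (ℤP.+-identityʳ (+ n))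
abs-parity -[1+ n ] = + suc n , identity (+ suc n)
  where
  identity : ∀ x → x ≡ ℤ.- x ℤ.+ + 2 ℤ.* x
  identity = ℤ-Solver.solve-∀

∣2m+w∣≢1+∣w∣ : ∀ m w → ℤ.∣ + 2 ℤ.* m ℤ.+ w ∣ ≢ suc ℤ.∣ w ∣
∣2m+w∣≢1+∣w∣ m w eq with abs-parity (+ 2 ℤ.* m ℤ.+ w) | abs-parity w
... | e , ∣z∣≡ | e′ , ∣w∣≡ = 2*i≢1 (m ℤ.+ e ℤ.- e′) (begin
  + 2 ℤ.* (m ℤ.+ e ℤ.- e′)                                ≡⟨ rearrange m w e e′ ⟩
  (+ 2 ℤ.* m ℤ.+ w ℤ.+ + 2 ℤ.* e) ℤ.- (w ℤ.+ + 2 ℤ.* e′)  ≡⟨ cong₂ ℤ._-_ ∣z∣≡ ∣w∣≡ ⟨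
  + ℤ.∣ + 2 ℤ.* m ℤ.+ w ∣ ℤ.- + ℤ.∣ w ∣                   ≡⟨ cong (λ n → + n ℤ.- + ℤ.∣ w ∣) eq ⟩
  + suc ℤ.∣ w ∣ ℤ.- + ℤ.∣ w ∣                             ≡⟨ cong (ℤ._- + ℤ.∣ w ∣) (ℤP.pos-+ 1 ℤ.∣ w ∣) ⟩
  + 1 ℤ.+ + ℤ.∣ w ∣ ℤ.- + ℤ.∣ w ∣                         ≡⟨ cancel (+ ℤ.∣ w ∣) ⟩
  + 1                                                     ∎)
  where
  open ≡-Reasoning
  rearrange : ∀ m w e e′ → + 2 ℤ.* (m ℤ.+ e ℤ.- e′) ≡ (+ 2 ℤ.* m ℤ.+ w ℤ.+ + 2 ℤ.* e) ℤ.- (w ℤ.+ + 2 ℤ.* e′)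
  rearrange = ℤ-Solver.solve-∀
  cancel : ∀ x → + 1 ℤ.+ x ℤ.- x ≡ + 1
  cancel = ℤ-Solver.solve-∀

same-parity : ∀ {k k′ m n} → Unitℤ n → k′ ≡ + 2 ℤ.* m ℤ.+ n ℤ.* k →
              ℤ.∣ k′ ∣ ≢ suc ℤ.∣ k ∣ × ℤ.∣ k ∣ ≢ suc ℤ.∣ k′ ∣
same-parity {k} {k′} {m} {n} n-unit k′≡2m+nk =
  subst₂ (λ u v → u ≢ suc v) (cong ℤ.∣_∣ (sym k′≡2m+nk)) (∣unit*i∣ k) (∣2m+w∣≢1+∣w∣ m (n ℤ.* k)) ,
  subst₂ (λ u v → u ≢ suc v) (cong ℤ.∣_∣ (sym k≡2m′+nk′)) (∣unit*i∣ k′)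
         (∣2m+w∣≢1+∣w∣ (ℤ.- (n ℤ.* m)) (n ℤ.* k′))
  where
  ∣unit*i∣ : ∀ i → ℤ.∣ n ℤ.* i ∣ ≡ ℤ.∣ i ∣
  ∣unit*i∣ i = trans (ℤP.abs-* n i) ([ (λ { refl → ℕP.*-identityˡ ℤ.∣ i ∣ })
                                      , (λ { refl → ℕP.*-identityˡ ℤ.∣ i ∣ }) ]′ n-unit)
  k≡2m′+nk′ : k ≡ + 2 ℤ.* ℤ.- (n ℤ.* m) ℤ.+ n ℤ.* k′
  k≡2m′+nk′ = begin
    k                                                        ≡⟨ ℤP.*-identityˡ k ⟨
    + 1 ℤ.* k                                                ≡⟨ cong (ℤ._* k) (unit*unit≡1 n-unit) ⟨
    n ℤ.* n ℤ.* k                                            ≡⟨ identity k m n ⟩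
    + 2 ℤ.* ℤ.- (n ℤ.* m) ℤ.+ n ℤ.* (+ 2 ℤ.* m ℤ.+ n ℤ.* k)
      ≡⟨ cong (λ u → + 2 ℤ.* ℤ.- (n ℤ.* m) ℤ.+ n ℤ.* u) k′≡2m+nk ⟨
    + 2 ℤ.* ℤ.- (n ℤ.* m) ℤ.+ n ℤ.* k′                        ∎
    where
    open ≡-Reasoning
    identity : ∀ k m n → n ℤ.* n ℤ.* k ≡ + 2 ℤ.* ℤ.- (n ℤ.* m) ℤ.+ n ℤ.* (+ 2 ℤ.* m ℤ.+ n ℤ.* k)
    identity = ℤ-Solver.solve-∀

-- Integers in a window (j − 1)² A ≤ S ≤ (j + 1)² A

Window : ℚ → ℚ → ℚ → Set
Window A S j = (j - 1ℚ) * (j - 1ℚ) * A ≤ S × S ≤ (j + 1ℚ) * (j + 1ℚ) * A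

window-value : ℚ → ℚ → ℚ → ℚ
window-value A S j = (j * j * A - S - A) * (j * j * A - S - A)

between : ∀ {l h S} → l ≤ h → 0ℚ ≤ (S - l) * (h - S) → l ≤ S × S ≤ h
between {l} {h} {S} l≤h 0≤product = above (l ℚP.≤? S) , below (S ℚP.≤? h)
  where
  ¬negative : ¬ (S - l) * (h - S) ℚ.< 0ℚ
  ¬negative product<0 = ℚP.<-irrefl refl (ℚP.<-≤-trans product<0 0≤product)
  above : Dec (l ≤ S) → l ≤ S
  above (yes l≤S) = l≤S
  above (no l≰S) = ⊥-elim (¬negative (neg*pos<0 (p<q⇒p-q<0 S<l) (p<q⇒0<q-p (ℚP.<-≤-trans S<l l≤h))))
    where
    S<l : S ℚ.< l
    S<l = ℚP.≰⇒> l≰S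
  below : Dec (S ≤ h) → S ≤ h
  below (yes S≤h) = S≤h
  below (no S≰h) = ⊥-elim (¬negative (pos*neg<0 (p<q⇒0<q-p (ℚP.≤-<-trans l≤h h<S)) (p<q⇒p-q<0 h<S)))
    where
    h<S : h ℚ.< S
    h<S = ℚP.≰⇒> S≰h

fromℤ-abs-square : ∀ k → fromℕ ℤ.∣ k ∣ * fromℕ ℤ.∣ k ∣ ≡ fromℤ k * fromℤ k
fromℤ-abs-square k = trans (sym (fromℤ-* (+ ℤ.∣ k ∣) (+ ℤ.∣ k ∣))) (trans (cong fromℤ (abs-square k)) (fromℤ-* k k))
  where
  abs-square : ∀ k → + ℤ.∣ k ∣ ℤ.* + ℤ.∣ k ∣ ≡ k ℤ.* k
  abs-square (+ n)    = refl
  abs-square -[1+ n ] = refl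

module _ {a b Δ : ℚ} (k : ℤ) (trace² : (fromℤ k * a) * (fromℤ k * a) ≡ Δ + 4ℚ * (a * b)) where

  private
    κ ∣κ∣ A S : ℚ
    κ = fromℤ k
    ∣κ∣ = fromℕ ℤ.∣ k ∣
    A = a * a
    S = Δ - 3ℚ * A
    Δ≡ : Δ ≡ (κ * a) * (κ * a) - 4ℚ * (a * b)
    Δ≡ = trans (sym (p+q-q≡p Δ (4ℚ * (a * b)))) (cong (_- 4ℚ * (a * b)) (sym trace²))
      where
      p+q-q≡p : ∀ p q → p + q - q ≡ p
      p+q-q≡p = solve-∀ ℚ-ring

  trace-bound⇒window : 4ℚ * ((a + b) * (a + b)) ≤ (κ * a) * (κ * a) → Window A S ∣κ∣
  trace-bound⇒window bound = between lo≤hi (subst (0ℚ ≤_) (sym product≡)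
    (*-nonNeg (*-nonNeg (fromℕ-nonNeg 4) (square-nonNeg a)) (p≤q⇒0≤q-p bound)))
    where
    open ≡-Reasoning
    lo≤hi : (∣κ∣ - 1ℚ) * (∣κ∣ - 1ℚ) * A ≤ (∣κ∣ + 1ℚ) * (∣κ∣ + 1ℚ) * A
    lo≤hi = 0≤p-q⇒q≤p (subst (0ℚ ≤_) (sym (difference ∣κ∣ A))
              (*-nonNeg (*-nonNeg (fromℕ-nonNeg 4) (fromℕ-nonNeg ℤ.∣ k ∣)) (square-nonNeg a)))
      where
      difference : ∀ j A → (j + 1ℚ) * (j + 1ℚ) * A - (j - 1ℚ) * (j - 1ℚ) * A ≡ 4ℚ * j * A
      difference = solve-∀ ℚ-ring
    P : ℚ → ℚ → ℚ
    P u d = 4ℚ * u * (A * A) - ((u + 1ℚ) * A - (d - 3ℚ * A)) * ((u + 1ℚ) * A - (d - 3ℚ * A))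
    product≡ : (S - (∣κ∣ - 1ℚ) * (∣κ∣ - 1ℚ) * A) * ((∣κ∣ + 1ℚ) * (∣κ∣ + 1ℚ) * A - S)
             ≡ 4ℚ * A * ((κ * a) * (κ * a) - 4ℚ * ((a + b) * (a + b)))
    product≡ = begin
      (S - (∣κ∣ - 1ℚ) * (∣κ∣ - 1ℚ) * A) * ((∣κ∣ + 1ℚ) * (∣κ∣ + 1ℚ) * A - S)  ≡⟨ in-terms-of-j² ∣κ∣ A S ⟩
      P (∣κ∣ * ∣κ∣) Δ                                                        ≡⟨ cong₂ P (fromℤ-abs-square k) Δ≡ ⟩
      P (κ * κ) ((κ * a) * (κ * a) - 4ℚ * (a * b))                           ≡⟨ in-terms-of-a,b κ a b ⟩
      4ℚ * A * ((κ * a) * (κ * a) - 4ℚ * ((a + b) * (a + b)))                ∎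
      where
      in-terms-of-j² : ∀ j A S → (S - (j - 1ℚ) * (j - 1ℚ) * A) * ((j + 1ℚ) * (j + 1ℚ) * A - S)
                     ≡ 4ℚ * (j * j) * (A * A) - ((j * j + 1ℚ) * A - S) * ((j * j + 1ℚ) * A - S)
      in-terms-of-j² = solve-∀ ℚ-ring
      in-terms-of-a,b : ∀ κ a b →
        4ℚ * (κ * κ) * ((a * a) * (a * a))
          - ((κ * κ + 1ℚ) * (a * a) - (((κ * a) * (κ * a) - 4ℚ * (a * b)) - 3ℚ * (a * a)))
          * ((κ * κ + 1ℚ) * (a * a) - (((κ * a) * (κ * a) - 4ℚ * (a * b)) - 3ℚ * (a * a)))
        ≡ 4ℚ * (a * a) * ((κ * a) * (κ * a) - 4ℚ * ((a + b) * (a + b)))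
      in-terms-of-a,b = solve-∀ ℚ-ring

  window-value≡ : 16ℚ * A * (b * (a + b)) ≡ window-value A S ∣κ∣ - 4ℚ * (A * A)
  window-value≡ = begin
    16ℚ * A * (b * (a + b))                       ≡⟨ in-terms-of-a,b κ a b ⟩
    V (κ * κ) ((κ * a) * (κ * a) - 4ℚ * (a * b))  ≡⟨ cong₂ V (fromℤ-abs-square k) Δ≡ ⟨
    V (∣κ∣ * ∣κ∣) Δ                               ∎
    where
    open ≡-Reasoning
    V : ℚ → ℚ → ℚ
    V u d = (u * A - (d - 3ℚ * A) - A) * (u * A - (d - 3ℚ * A) - A) - 4ℚ * (A * A)
    in-terms-of-a,b : ∀ κ a b → 16ℚ * (a * a) * (b * (a + b))
      ≡ ((κ * κ) * (a * a) - (((κ * a) * (κ * a) - 4ℚ * (a * b)) - 3ℚ * (a * a)) - a * a)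
        * ((κ * κ) * (a * a) - (((κ * a) * (κ * a) - 4ℚ * (a * b)) - 3ℚ * (a * a)) - a * a)
        - 4ℚ * ((a * a) * (a * a))
    in-terms-of-a,b = solve-∀ ℚ-ring

module _ {A S : ℚ} (0<A : 0ℚ ℚ.< A) where

  windows-2-apart : ∀ j → Window A S j → Window A S (j + 2ℚ) → window-value A S j ≡ window-value A S (j + 2ℚ)
  windows-2-apart j (_ , S≤hi) (lo′≤S , _) = begin
    window-value A S j                                 ≡⟨ cong (λ u → window-value A u j) S≡hi ⟩
    window-value A ((j + 1ℚ) * (j + 1ℚ) * A) j         ≡⟨ symmetric j A ⟩
    window-value A ((j + 1ℚ) * (j + 1ℚ) * A) (j + 2ℚ)  ≡⟨ cong (λ u → window-value A u (j + 2ℚ)) S≡hi ⟨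
    window-value A S (j + 2ℚ)                          ∎
    where
    open ≡-Reasoning
    touching : ∀ j A → (j + 2ℚ - 1ℚ) * (j + 2ℚ - 1ℚ) * A ≡ (j + 1ℚ) * (j + 1ℚ) * A
    touching = solve-∀ ℚ-ring
    S≡hi : S ≡ (j + 1ℚ) * (j + 1ℚ) * A
    S≡hi = ℚP.≤-antisym S≤hi (subst (_≤ S) (touching j A) lo′≤S)
    symmetric : ∀ j A →
      (j * j * A - (j + 1ℚ) * (j + 1ℚ) * A - A) * (j * j * A - (j + 1ℚ) * (j + 1ℚ) * A - A)
      ≡ ((j + 2ℚ) * (j + 2ℚ) * A - (j + 1ℚ) * (j + 1ℚ) * A - A) * ((j + 2ℚ) * (j + 2ℚ) * A - (j + 1ℚ) * (j + 1ℚ) * A - A)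
    symmetric = solve-∀ ℚ-ring

  windows-far-apart : ∀ {j e} → 0ℚ ≤ j → 0ℚ ≤ e → Window A S j → ¬ Window A S (j + (3ℚ + e))
  windows-far-apart {j} {e} 0≤j 0≤e (_ , S≤hi) (lo′≤S , _) =
    ℚP.<-irrefl refl (ℚP.<-≤-trans hi<lo′ (ℚP.≤-trans lo′≤S S≤hi))
    where
    gap : ∀ j e A → (j + (3ℚ + e) - 1ℚ) * (j + (3ℚ + e) - 1ℚ) * A - (j + 1ℚ) * (j + 1ℚ) * A
                  ≡ (1ℚ + e) * (3ℚ + (2ℚ * j + e)) * A
    gap = solve-∀ ℚ-ring
    hi<lo′ : (j + 1ℚ) * (j + 1ℚ) * A ℚ.< (j + (3ℚ + e) - 1ℚ) * (j + (3ℚ + e) - 1ℚ) * A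
    hi<lo′ = 0<p-q⇒q<p (subst (0ℚ ℚ.<_) (sym (gap j e A))
      (*-pos (*-pos (+-pos-nonNeg (ℚP.positive⁻¹ 1ℚ) 0≤e)
                    (+-pos-nonNeg (ℚP.positive⁻¹ 3ℚ) (+-nonNeg (*-nonNeg (fromℕ-nonNeg 2) 0≤j) 0≤e)))
             0<A))

  windows-ordered : ∀ j δ → δ ≢ 1 → Window A S (fromℕ j) → Window A S (fromℕ (j ℕ.+ δ)) →
                    window-value A S (fromℕ j) ≡ window-value A S (fromℕ (j ℕ.+ δ))
  windows-ordered j 0 _ _ _ = cong (λ n → window-value A S (fromℕ n)) (sym (ℕP.+-identityʳ j))
  windows-ordered j 1 δ≢1 _ _ = ⊥-elim (δ≢1 refl)
  windows-ordered j 2 _ w w′ = trans (windows-2-apart (fromℕ j) w (subst (Window A S) (fromℕ-+ j 2) w′))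
                                     (cong (window-value A S) (sym (fromℕ-+ j 2)))
  windows-ordered j (suc (suc (suc d))) _ w w′ = ⊥-elim (windows-far-apart (fromℕ-nonNeg j) (fromℕ-nonNeg d) w
    (subst (Window A S) (trans (fromℕ-+ j (3 ℕ.+ d)) (cong (λ u → fromℕ j + u) (fromℕ-+ 3 d))) w′))

  windows-same-parity : ∀ j₁ j₂ → j₂ ≢ suc j₁ → j₁ ≢ suc j₂ →
                        Window A S (fromℕ j₁) → Window A S (fromℕ j₂) →
                        window-value A S (fromℕ j₁) ≡ window-value A S (fromℕ j₂)
  windows-same-parity j₁ j₂ j₂≢1+j₁ j₁≢1+j₂ w₁ w₂ =
    [ ordered j₁ j₂ j₂≢1+j₁ w₁ w₂ , (λ j₂≤j₁ → sym (ordered j₂ j₁ j₁≢1+j₂ w₂ w₁ j₂≤j₁)) ]′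
      (ℕP.≤-total j₁ j₂)
    where
    ordered : ∀ j j′ → j′ ≢ suc j → Window A S (fromℕ j) → Window A S (fromℕ j′) → j ℕ.≤ j′ →
              window-value A S (fromℕ j) ≡ window-value A S (fromℕ j′)
    ordered j j′ j′≢1+j w w′ j≤j′ = subst (λ n → window-value A S (fromℕ j) ≡ window-value A S (fromℕ n)) j+δ≡j′
      (windows-ordered j δ (λ δ≡1 → j′≢1+j (trans (sym j+δ≡j′) (trans (cong (j ℕ.+_) δ≡1) (ℕP.+-comm j 1))))
                       w (subst (λ n → Window A S (fromℕ n)) (sym j+δ≡j′) w′))
      where
      δ : ℕ
      δ = j′ ℕ.∸ j
      j+δ≡j′ : j ℕ.+ δ ≡ j′
      j+δ≡j′ = ℕP.m+[n∸m]≡n j≤j′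

norm-product-determined : ∀ a Δ b₁ b₂ k₁ k₂ {m n} → a ≢ 0ℚ → Unitℤ n → k₂ ≡ + 2 ℤ.* m ℤ.+ n ℤ.* k₁ →
  (fromℤ k₁ * a) * (fromℤ k₁ * a) ≡ Δ + 4ℚ * (a * b₁) →
  (fromℤ k₂ * a) * (fromℤ k₂ * a) ≡ Δ + 4ℚ * (a * b₂) →
  4ℚ * ((a + b₁) * (a + b₁)) ≤ (fromℤ k₁ * a) * (fromℤ k₁ * a) →
  4ℚ * ((a + b₂) * (a + b₂)) ≤ (fromℤ k₂ * a) * (fromℤ k₂ * a) →
  b₁ * (a + b₁) ≡ b₂ * (a + b₂)
norm-product-determined a Δ b₁ b₂ k₁ k₂ {m} {n} a≢0 n-unit k₂≡2m+nk₁ trace²₁ trace²₂ bound₁ bound₂ =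
  *-cancelˡ-≢0 (16ℚ * A) 16A≢0 (begin
    16ℚ * A * (b₁ * (a + b₁))                         ≡⟨ window-value≡ {a} {b₁} {Δ} k₁ trace²₁ ⟩
    window-value A S (fromℕ ℤ.∣ k₁ ∣) - 4ℚ * (A * A)  ≡⟨ cong (_- 4ℚ * (A * A)) same-window-value ⟩
    window-value A S (fromℕ ℤ.∣ k₂ ∣) - 4ℚ * (A * A)  ≡⟨ window-value≡ {a} {b₂} {Δ} k₂ trace²₂ ⟨
    16ℚ * A * (b₂ * (a + b₂))                         ∎)
  where
  open ≡-Reasoning
  A S : ℚ
  A = a * a
  S = Δ - 3ℚ * A
  0<A : 0ℚ ℚ.< A
  0<A = square-pos a a≢0
  16A≢0 : 16ℚ * A ≢ 0ℚ
  16A≢0 16A≡0 = ℚP.<-irrefl (sym 16A≡0) (*-pos (ℚP.positive⁻¹ 16ℚ) 0<A)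
  parity : ℤ.∣ k₂ ∣ ≢ suc ℤ.∣ k₁ ∣ × ℤ.∣ k₁ ∣ ≢ suc ℤ.∣ k₂ ∣
  parity = same-parity {k₁} {k₂} {m} {n} n-unit k₂≡2m+nk₁
  same-window-value : window-value A S (fromℕ ℤ.∣ k₁ ∣) ≡ window-value A S (fromℕ ℤ.∣ k₂ ∣)
  same-window-value = windows-same-parity 0<A ℤ.∣ k₁ ∣ ℤ.∣ k₂ ∣ (proj₁ parity) (proj₂ parity)
    (trace-bound⇒window {a} {b₁} {Δ} k₁ trace²₁ bound₁) (trace-bound⇒window {a} {b₂} {Δ} k₂ trace²₂ bound₂)

-- Square-free numbers are not squares of rationals

prime-divisor : ∀ {n} → 1 < n → ∃[ p ] Prime p × p ∣ n
prime-divisor {n} 1<n with factorise n {{ℕ.>-nonZero (ℕP.<-trans (s≤s z≤n) 1<n)}}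
... | record { factors = [] ; isFactorisation = n≡1 } = ⊥-elim (ℕP.<-irrefl (sym n≡1) 1<n)
... | record { factors = p ∷ ps ; isFactorisation = n≡p*ps ; factorsPrime = p-prime ∷ _ } =
  p , p-prime , divides (product ps) (trans n≡p*ps (ℕP.*-comm p (product ps)))

prime-∣-square : ∀ {p} w → Prime p → p ∣ w ℕ.* w → p ∣ w
prime-∣-square w p-prime p∣w² = [ (λ h → h) , (λ h → h) ]′ (euclidsLemma w w p-prime p∣w²)

square-descent : ∀ {d p} → Prime p → ¬ p ∣ d → ∀ u v → u ℕ.* u ≡ d ℕ.* p ℕ.* (v ℕ.* v) →
                 ∃[ u′ ] ∃[ v′ ] v ≡ v′ ℕ.* p × u′ ℕ.* u′ ≡ d ℕ.* p ℕ.* (v′ ℕ.* v′)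
square-descent {d} {p} p-prime p∤d u v eq
  with prime-∣-square u p-prime (subst (p ∣_) (sym eq) (∣-trans (n∣m*n d) (m∣m*n (v ℕ.* v))))
... | divides u′ refl = descend (prime-∣-square v p-prime p∣v²)
  where
  open ≡-Reasoning
  open +-*-Solver
  instance
    p-nonZero : ℕ.NonZero p
    p-nonZero = prime⇒nonZero p-prime
  u′²p≡dv² : u′ ℕ.* u′ ℕ.* p ≡ d ℕ.* (v ℕ.* v)
  u′²p≡dv² = ℕP.*-cancelʳ-≡ _ _ p (begin
    u′ ℕ.* u′ ℕ.* p ℕ.* p    ≡⟨ solve 2 (λ u p → u :* u :* p :* p := u :* p :* (u :* p)) refl u′ p ⟩
    u′ ℕ.* p ℕ.* (u′ ℕ.* p)  ≡⟨ eq ⟩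
    d ℕ.* p ℕ.* (v ℕ.* v)    ≡⟨ solve 3 (λ d p v → d :* p :* (v :* v) := d :* (v :* v) :* p) refl d p v ⟩
    d ℕ.* (v ℕ.* v) ℕ.* p    ∎)
  p∣v² : p ∣ v ℕ.* v
  p∣v² = [ (λ p∣d → ⊥-elim (p∤d p∣d)) , (λ h → h) ]′
           (euclidsLemma d (v ℕ.* v) p-prime (divides (u′ ℕ.* u′) (sym u′²p≡dv²)))
  descend : p ∣ v → ∃[ u″ ] ∃[ v′ ] v ≡ v′ ℕ.* p × u″ ℕ.* u″ ≡ d ℕ.* p ℕ.* (v′ ℕ.* v′)
  descend (divides v′ v≡v′p) = u′ , v′ , v≡v′p , ℕP.*-cancelʳ-≡ _ _ p (begin
    u′ ℕ.* u′ ℕ.* p                   ≡⟨ u′²p≡dv² ⟩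
    d ℕ.* (v ℕ.* v)                   ≡⟨ cong (λ w → d ℕ.* (w ℕ.* w)) v≡v′p ⟩
    d ℕ.* (v′ ℕ.* p ℕ.* (v′ ℕ.* p))
      ≡⟨ solve 3 (λ d p v → d :* (v :* p :* (v :* p)) := d :* p :* (v :* v) :* p) refl d p v′ ⟩
    d ℕ.* p ℕ.* (v′ ℕ.* v′) ℕ.* p         ∎)

square-free⇒non-square : ∀ {D} → SquareFree D → 1 < D → ∀ u v → u ℕ.* u ≡ D ℕ.* (v ℕ.* v) → v ≡ 0
square-free⇒non-square {D} sqf 1<D with prime-divisor 1<D
... | p , p-prime , divides d refl = λ u v → <-rec P step v u
  where
  P : ℕ → Set
  P v = ∀ u → u ℕ.* u ≡ d ℕ.* p ℕ.* (v ℕ.* v) → v ≡ 0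
  p∤d : ¬ p ∣ d
  p∤d (divides e refl) = sqf p p-prime (divides e (ℕP.*-assoc e p p))
  shrinks : ∀ {v} v′ → suc v ≡ v′ ℕ.* p → v′ < suc v
  shrinks v′@(suc _) eq =
    subst (v′ <_) (sym eq) (ℕP.m<m*n v′ p (ℕ.nonTrivial⇒n>1 p {{prime⇒nonTrivial p-prime}}))
  step : ∀ v → (∀ {w} → w < v → P w) → P v
  step zero _ _ _ = refl
  step (suc v) rec u eq with square-descent p-prime p∤d u (suc v) eq
  ... | u′ , v′ , v≡v′p , eq′ = trans v≡v′p (cong (ℕ._* p) (rec (shrinks v′ v≡v′p) u′ eq′))

square-free⇒non-squareℚ : ∀ {D} → SquareFree D → 1 < D →
                          ∀ a b → a * a ≡ fromℕ D * (b * b) → b ≡ 0ℚ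
square-free⇒non-squareℚ {D} sqf 1<D a@(mkℚ n da _) b@(mkℚ m db _) eq =
  ℚP.↥p≡0⇒p≡0 b (ℤP.∣i∣≡0⇒i≡0 ∣m∣≡0)
  where
  open ≡-Reasoning
  ∣n∣ ∣m∣ sa sb : ℕ
  ∣n∣ = ℤ.∣ n ∣
  ∣m∣ = ℤ.∣ m ∣
  sa = suc da
  sb = suc db
  ∣i*i*k∣ : ∀ i k → ℤ.∣ i ℤ.* i ℤ.* + k ∣ ≡ ℤ.∣ i ∣ ℕ.* ℤ.∣ i ∣ ℕ.* k
  ∣i*i*k∣ i k = trans (ℤP.abs-* (i ℤ.* i) (+ k)) (cong (ℕ._* k) (ℤP.abs-* i i))
  cross : n ℤ.* n ℤ.* + (1 ℕ.* (sb ℕ.* sb)) ≡ + D ℤ.* (m ℤ.* m) ℤ.* + (sa ℕ.* sa)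
  cross = ℚᵘP.drop-*≡* (ℚᵘP.≃-trans (ℚᵘP.≃-sym (ℚP.toℚᵘ-homo-* a a))
            (ℚᵘP.≃-trans (ℚP.toℚᵘ-cong (trans eq (cong (_* (b * b)) (fromℤ≡mkℚ/1 (+ D)))))
            (ℚᵘP.≃-trans (ℚP.toℚᵘ-homo-* (mkℚ/1 (+ D)) (b * b)) (ℚᵘP.*-congˡ (ℚP.toℚᵘ-homo-* b b)))))
  natural : (∣n∣ ℕ.* sb) ℕ.* (∣n∣ ℕ.* sb) ≡ D ℕ.* ((∣m∣ ℕ.* sa) ℕ.* (∣m∣ ℕ.* sa))
  natural = begin
    (∣n∣ ℕ.* sb) ℕ.* (∣n∣ ℕ.* sb)
      ≡⟨ solve 2 (λ x y → (x :* y) :* (x :* y) := x :* x :* (con 1 :* (y :* y))) refl ∣n∣ sb ⟩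
    ∣n∣ ℕ.* ∣n∣ ℕ.* (1 ℕ.* (sb ℕ.* sb))        ≡⟨ ∣i*i*k∣ n (1 ℕ.* (sb ℕ.* sb)) ⟨
    ℤ.∣ n ℤ.* n ℤ.* + (1 ℕ.* (sb ℕ.* sb)) ∣   ≡⟨ cong ℤ.∣_∣ cross ⟩
    ℤ.∣ + D ℤ.* (m ℤ.* m) ℤ.* + (sa ℕ.* sa) ∣ ≡⟨ ℤP.abs-* (+ D ℤ.* (m ℤ.* m)) _ ⟩
    ℤ.∣ + D ℤ.* (m ℤ.* m) ∣ ℕ.* (sa ℕ.* sa)
      ≡⟨ cong (ℕ._* (sa ℕ.* sa)) (trans (ℤP.abs-* (+ D) (m ℤ.* m)) (cong (D ℕ.*_) (ℤP.abs-* m m))) ⟩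
    D ℕ.* (∣m∣ ℕ.* ∣m∣) ℕ.* (sa ℕ.* sa)
      ≡⟨ solve 3 (λ d x y → d :* (x :* x) :* (y :* y) := d :* ((x :* y) :* (x :* y))) refl D ∣m∣ sa ⟩
    D ℕ.* ((∣m∣ ℕ.* sa) ℕ.* (∣m∣ ℕ.* sa))     ∎
    where open +-*-Solver
  ∣m∣≡0 : ℤ.∣ m ∣ ≡ 0
  ∣m∣≡0 = ℕP.m*n≡0⇒m≡0 ℤ.∣ m ∣ (suc da) (square-free⇒non-square sqf 1<D (∣n∣ ℕ.* sb) (∣m∣ ℕ.* sa) natural)

module QuadraticField (D : ℕ) where
  open QF D

  module _ where
    open ℚSolver.+-*-Solver

    +K-assoc : ∀ x y z → (x +K y) +K z ≡ x +K (y +K z)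
    +K-assoc (a , b) (c , d) (e , f) = cong₂ _,_ (ℚP.+-assoc a c e) (ℚP.+-assoc b d f)

    +K-comm : ∀ x y → x +K y ≡ y +K x
    +K-comm (a , b) (c , d) = cong₂ _,_ (ℚP.+-comm a c) (ℚP.+-comm b d)

    +K-identityˡ : ∀ x → 0K +K x ≡ x
    +K-identityˡ (a , b) = cong₂ _,_ (ℚP.+-identityˡ a) (ℚP.+-identityˡ b)

    *K-assoc : ∀ x y z → (x *K y) *K z ≡ x *K (y *K z)
    *K-assoc (a , b) (c , d) (e , f) = cong₂ _,_
      (solve 7 (λ a b c d e f δ →
          (a :* c :+ δ :* (b :* d)) :* e :+ δ :* ((a :* d :+ b :* c) :* f)
       := a :* (c :* e :+ δ :* (d :* f)) :+ δ :* (b :* (c :* f :+ d :* e))) refl a b c d e f Dℚ)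
      (solve 7 (λ a b c d e f δ →
          (a :* c :+ δ :* (b :* d)) :* f :+ (a :* d :+ b :* c) :* e
       := a :* (c :* f :+ d :* e) :+ b :* (c :* e :+ δ :* (d :* f))) refl a b c d e f Dℚ)

    *K-comm : ∀ x y → x *K y ≡ y *K x
    *K-comm (a , b) (c , d) = cong₂ _,_
      (cong₂ _+_ (ℚP.*-comm a c) (cong (Dℚ *_) (ℚP.*-comm b d)))
      (trans (ℚP.+-comm (a * d) (b * c)) (cong₂ _+_ (ℚP.*-comm b c) (ℚP.*-comm a d)))

    *K-identityˡ : ∀ x → 1K *K x ≡ x
    *K-identityˡ (a , b) = cong₂ _,_
      (solve 3 (λ a b δ → con 1ℚ :* a :+ δ :* (con 0ℚ :* b) := a) refl a b Dℚ)
      (solve 2 (λ a b → con 1ℚ :* b :+ con 0ℚ :* a := b) refl a b)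

    *K-distribʳ-+K : ∀ x y z → (y +K z) *K x ≡ (y *K x) +K (z *K x)
    *K-distribʳ-+K (a , b) (c , d) (e , f) = cong₂ _,_
      (solve 7 (λ a b c d e f δ →
          (c :+ e) :* a :+ δ :* ((d :+ f) :* b) := (c :* a :+ δ :* (d :* b)) :+ (e :* a :+ δ :* (f :* b)))
        refl a b c d e f Dℚ)
      (solve 6 (λ a b c d e f → (c :+ e) :* b :+ (d :+ f) :* a := (c :* b :+ d :* a) :+ (e :* b :+ f :* a))
        refl a b c d e f)

    *K-zeroˡ : ∀ x → 0K *K x ≡ 0K
    *K-zeroˡ (a , b) = cong₂ _,_
      (solve 3 (λ a b δ → con 0ℚ :* a :+ δ :* (con 0ℚ :* b) := con 0ℚ) refl a b Dℚ)
      (solve 2 (λ a b → con 0ℚ :* b :+ con 0ℚ :* a := con 0ℚ) refl a b)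

    -K‿*K-distribˡ : ∀ x y → (-K x) *K y ≡ -K (x *K y)
    -K‿*K-distribˡ (a , b) (c , d) = cong₂ _,_
      (solve 5 (λ a b c d δ → (:- a) :* c :+ δ :* ((:- b) :* d) := :- (a :* c :+ δ :* (b :* d))) refl a b c d Dℚ)
      (solve 4 (λ a b c d → (:- a) :* d :+ (:- b) :* c := :- (a :* d :+ b :* c)) refl a b c d)

    -K‿+K-comm : ∀ x y → (-K x) +K (-K y) ≡ -K (x +K y)
    -K‿+K-comm (a , b) (c , d) = cong₂ _,_ (sym (ℚP.neg-distrib-+ a c)) (sym (ℚP.neg-distrib-+ b d))

  K-almostCommutativeRing : AlmostCommutativeRing _ _
  K-almostCommutativeRing = record
    { Carrier = K ; _≈_ = _≡_ ; _+_ = _+K_ ; _*_ = _*K_ ; -_ = -K_ ; 0# = 0K ; 1# = 1K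
    ; isAlmostCommutativeRing = record
      { isCommutativeSemiring = isCommutativeSemiringˡ record
        { +-isCommutativeMonoid = isCommutativeMonoidˡ record
            { isSemigroup = record
              { isMagma = record { isEquivalence = isEquivalence ; ∙-cong = cong₂ _+K_ }
              ; assoc = +K-assoc }
            ; identityˡ = +K-identityˡ ; comm = +K-comm }
        ; *-isCommutativeMonoid = isCommutativeMonoidˡ record
            { isSemigroup = record
              { isMagma = record { isEquivalence = isEquivalence ; ∙-cong = cong₂ _*K_ }
              ; assoc = *K-assoc }
            ; identityˡ = *K-identityˡ ; comm = *K-comm }
        ; distribʳ = *K-distribʳ-+K
        ; zeroˡ = *K-zeroˡ }
      ; -‿cong = cong (λ x → -K x)
      ; -‿*-distribˡ = -K‿*K-distribˡ
      ; -‿+-comm = -K‿+K-comm } }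

  intK-+ : ∀ i j → intK (i ℤ.+ j) ≡ intK i +K intK j
  intK-+ i j = cong₂ _,_ (fromℤ-+ i j) refl

  intK-* : ∀ i j → intK (i ℤ.* j) ≡ intK i *K intK j
  intK-* i j = cong₂ _,_
    (trans (fromℤ-* i j) (solve 3 (λ p q δ → p :* q := p :* q :+ δ :* (con 0ℚ :* con 0ℚ)) refl (fromℤ i) (fromℤ j) Dℚ))
    (solve 2 (λ p q → con 0ℚ := p :* con 0ℚ :+ con 0ℚ :* q) refl (fromℤ i) (fromℤ j))
    where open ℚSolver.+-*-Solver

  intK-neg : ∀ i → intK (ℤ.- i) ≡ -K intK i
  intK-neg i = cong₂ _,_ (fromℤ-neg i) refl

  intK-homomorphism : ℤ.+-*-rawRing -Raw-AlmostCommutative⟶ K-almostCommutativeRing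
  intK-homomorphism = record
    { ⟦_⟧ = intK ; +-homo = intK-+ ; *-homo = intK-* ; -‿homo = intK-neg ; 0-homo = refl ; 1-homo = refl }

  module KSolver = Algebra.Solver.Ring ℤ.+-*-rawRing K-almostCommutativeRing intK-homomorphism
    (λ i j → Maybe.map (cong intK) (dec⇒maybe (i ℤ.≟ j)))

  σ-+ : ∀ x y → σ (x +K y) ≡ σ x +K σ y
  σ-+ (a , b) (c , d) = cong (a + c ,_) (ℚP.neg-distrib-+ b d)

  σ-* : ∀ x y → σ (x *K y) ≡ σ x *K σ y
  σ-* (a , b) (c , d) = cong₂ _,_
    (solve 5 (λ a b c d δ → a :* c :+ δ :* (b :* d) := a :* c :+ δ :* ((:- b) :* (:- d))) refl a b c d Dℚ)
    (solve 4 (λ a b c d → :- (a :* d :+ b :* c) := a :* (:- d) :+ (:- b) :* c) refl a b c d)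
    where open ℚSolver.+-*-Solver

  σ-involutive : ∀ x → σ (σ x) ≡ x
  σ-involutive (a , b) = cong (a ,_) (neg-involutive b)

  σ-lin : ∀ m x n y → σ (lin m x n y) ≡ lin m (σ x) n (σ y)
  σ-lin m x n y = trans (σ-+ (intK m *K x) (intK n *K y)) (cong₂ _+K_ (σ-* (intK m) x) (σ-* (intK n) y))

  emb-* : ∀ p q → emb p *K emb q ≡ emb (p * q)
  emb-* p q = cong₂ _,_
    (solve 3 (λ p q δ → p :* q :+ δ :* (con 0ℚ :* con 0ℚ) := p :* q) refl p q Dℚ)
    (solve 2 (λ p q → p :* con 0ℚ :+ con 0ℚ :* q := con 0ℚ) refl p q)
    where open ℚSolver.+-*-Solver

  emb-*K : ∀ q a b → emb q *K (a , b) ≡ (q * a , q * b)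
  emb-*K q a b = cong₂ _,_
    (solve 4 (λ q a b δ → q :* a :+ δ :* (con 0ℚ :* b) := q :* a) refl q a b Dℚ)
    (solve 3 (λ q a b → q :* b :+ con 0ℚ :* a := q :* b) refl q a b)
    where open ℚSolver.+-*-Solver

  emb-injective : ∀ {p q} → emb p ≡ emb q → p ≡ q
  emb-injective = cong proj₁

  *K-σ≡N : ∀ x → x *K σ x ≡ emb (N x)
  *K-σ≡N (a , b) = cong₂ _,_
    (solve 3 (λ a b δ → a :* a :+ δ :* (b :* (:- b)) := a :* a :- δ :* (b :* b)) refl a b Dℚ)
    (solve 2 (λ a b → a :* (:- b) :+ b :* a := con 0ℚ) refl a b)
    where open ℚSolver.+-*-Solver

  emb-*K≡0 : ∀ q z → emb q *K z ≡ 0K → q ≡ 0ℚ ⊎ z ≡ 0K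
  emb-*K≡0 q (a , b) eq = combine (p*q≡0⇒p≡0∨q≡0 q a (cong proj₁ eq′)) (p*q≡0⇒p≡0∨q≡0 q b (cong proj₂ eq′))
    where
    eq′ : (q * a , q * b) ≡ 0K
    eq′ = trans (sym (emb-*K q a b)) eq
    combine : q ≡ 0ℚ ⊎ a ≡ 0ℚ → q ≡ 0ℚ ⊎ b ≡ 0ℚ → q ≡ 0ℚ ⊎ (a , b) ≡ 0K
    combine (inj₁ q≡0) _          = inj₁ q≡0
    combine (inj₂ _)   (inj₁ q≡0) = inj₁ q≡0
    combine (inj₂ a≡0) (inj₂ b≡0) = inj₂ (cong₂ _,_ a≡0 b≡0)

  det trace : K → K → K
  det   x y = (x *K σ y) -K (σ x *K y)
  trace x y = (x *K σ y) +K (σ x *K y)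

  x-K-x≡0K : ∀ x → x -K x ≡ 0K
  x-K-x≡0K (a , b) = cong₂ _,_ (ℚP.+-inverseʳ a) (ℚP.+-inverseʳ b)

  u-v≡0⇒u≡v : ∀ {u v} → u -K v ≡ 0K → u ≡ v
  u-v≡0⇒u≡v {u} {v} u-v≡0 = begin
    u              ≡⟨ solve 2 (λ u v → u := (u :- v) :+ v) refl u v ⟩
    (u -K v) +K v  ≡⟨ cong (_+K v) u-v≡0 ⟩
    0K +K v        ≡⟨ +K-identityˡ v ⟩
    v              ∎
    where
    open ≡-Reasoning
    open KSolver

  -K-involutive : ∀ x → -K (-K x) ≡ x
  -K-involutive (a , b) = cong₂ _,_ (neg-involutive a) (neg-involutive b)

  *K-zeroʳ : ∀ x → x *K 0K ≡ 0K
  *K-zeroʳ x = trans (*K-comm x 0K) (*K-zeroˡ x)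

  PosK-scale : ∀ {q} z → 0ℚ ℚ.< q → PosK z → PosK (emb q *K z)
  PosK-scale {q} (a , b) 0<q z>0 = subst PosK (sym (emb-*K q a b)) (scale z>0)
    where
    instance
      q⁺ : ℚ.Positive q
      q⁺ = ℚ.positive 0<q
      q⁰⁺ : ℚ.NonNegative q
      q⁰⁺ = ℚP.pos⇒nonNeg q
      q²⁺ : ℚ.Positive (q * q)
      q²⁺ = ℚP.pos*pos⇒pos q q
    square-scale : ∀ q c → (q * q) * (c * c) ≡ (q * c) * (q * c)
    square-scale = solve-∀ ℚ-ring
    δ-square-scale : ∀ q δ c → (q * q) * (δ * (c * c)) ≡ δ * ((q * c) * (q * c))
    δ-square-scale = solve-∀ ℚ-ring
    scale-< : ∀ {u v} → u ℚ.< v → (q * q) * u ℚ.< (q * q) * v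
    scale-< = ℚP.*-monoʳ-<-pos (q * q)
    scale : PosK (a , b) → PosK (q * a , q * b)
    scale (inj₁ (a⁺ , b⁰⁺)) = inj₁ (ℚP.pos*pos⇒pos q a {{a⁺}} , ℚP.nonNeg*nonNeg⇒nonNeg q b {{b⁰⁺}})
    scale (inj₂ (inj₁ (a⁰⁺ , b⁺))) = inj₂ (inj₁ (ℚP.nonNeg*nonNeg⇒nonNeg q a {{a⁰⁺}} , ℚP.pos*pos⇒pos q b {{b⁺}}))
    scale (inj₂ (inj₂ (inj₁ (a⁺ , b⁻ , Db²<a²)))) =
      inj₂ (inj₂ (inj₁ (ℚP.pos*pos⇒pos q a {{a⁺}} , ℚP.pos*neg⇒neg q b {{b⁻}} ,
      subst₂ ℚ._<_ (δ-square-scale q Dℚ b) (square-scale q a) (scale-< Db²<a²))))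
    scale (inj₂ (inj₂ (inj₂ (a⁻ , b⁺ , a²<Db²)))) =
      inj₂ (inj₂ (inj₂ (ℚP.pos*neg⇒neg q a {{a⁻}} , ℚP.pos*pos⇒pos q b {{b⁺}} ,
      subst₂ ℚ._<_ (square-scale q a) (δ-square-scale q Dℚ b) (scale-< a²<Db²))))

  PosK-antisym : ∀ z → PosK z → ¬ PosK (-K z)
  PosK-antisym (a , b) = antisym
    where
    antisym : PosK (a , b) → ¬ PosK (- a , - b)
    antisym (inj₁ (a⁺ , _))                   (inj₁ (-a⁺ , _))                   = pos⇒¬pos-neg a a⁺ -a⁺
    antisym (inj₁ (a⁺ , _))                   (inj₂ (inj₁ (-a⁰⁺ , _)))           = pos⇒¬nonNeg-neg a a⁺ -a⁰⁺
    antisym (inj₁ (a⁺ , _))                   (inj₂ (inj₂ (inj₁ (-a⁺ , _))))     = pos⇒¬pos-neg a a⁺ -a⁺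
    antisym (inj₁ (_ , b⁰⁺))                  (inj₂ (inj₂ (inj₂ (_ , -b⁺ , _)))) = nonNeg⇒¬pos-neg b b⁰⁺ -b⁺
    antisym (inj₂ (inj₁ (_ , b⁺)))            (inj₁ (_ , -b⁰⁺))                  = pos⇒¬nonNeg-neg b b⁺ -b⁰⁺
    antisym (inj₂ (inj₁ (_ , b⁺)))            (inj₂ (inj₁ (_ , -b⁺)))            = pos⇒¬pos-neg b b⁺ -b⁺
    antisym (inj₂ (inj₁ (a⁰⁺ , _)))           (inj₂ (inj₂ (inj₁ (-a⁺ , _))))     = nonNeg⇒¬pos-neg a a⁰⁺ -a⁺
    antisym (inj₂ (inj₁ (_ , b⁺)))            (inj₂ (inj₂ (inj₂ (_ , -b⁺ , _)))) = pos⇒¬pos-neg b b⁺ -b⁺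
    antisym (inj₂ (inj₂ (inj₁ (a⁺ , _))))     (inj₁ (-a⁺ , _))                   = pos⇒¬pos-neg a a⁺ -a⁺
    antisym (inj₂ (inj₂ (inj₁ (a⁺ , _))))     (inj₂ (inj₁ (-a⁰⁺ , _)))           = pos⇒¬nonNeg-neg a a⁺ -a⁰⁺
    antisym (inj₂ (inj₂ (inj₁ (a⁺ , _))))     (inj₂ (inj₂ (inj₁ (-a⁺ , _))))     = pos⇒¬pos-neg a a⁺ -a⁺
    antisym (inj₂ (inj₂ (inj₁ (_ , _ , Db²<a²)))) (inj₂ (inj₂ (inj₂ (_ , _ , a²<Db²)))) =
      ℚP.<-asym Db²<a² (subst₂ ℚ._<_ (neg-square a) (cong (Dℚ *_) (neg-square b)) a²<Db²)
    antisym (inj₂ (inj₂ (inj₂ (_ , b⁺ , _)))) (inj₁ (_ , -b⁰⁺))                  = pos⇒¬nonNeg-neg b b⁺ -b⁰⁺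
    antisym (inj₂ (inj₂ (inj₂ (_ , b⁺ , _)))) (inj₂ (inj₁ (_ , -b⁺)))            = pos⇒¬pos-neg b b⁺ -b⁺
    antisym (inj₂ (inj₂ (inj₂ (_ , _ , a²<Db²)))) (inj₂ (inj₂ (inj₁ (_ , _ , Db²<a²)))) =
      ℚP.<-asym a²<Db² (subst₂ ℚ._<_ (cong (Dℚ *_) (neg-square b)) (neg-square a) Db²<a²)
    antisym (inj₂ (inj₂ (inj₂ (a⁻ , _))))     (inj₂ (inj₂ (inj₂ (-a⁻ , _))))     = neg⇒¬neg-neg a a⁻ -a⁻

  NonNegK : K → Set
  NonNegK z = z ≡ 0K ⊎ PosK z

  ≤K⇒NonNegK : ∀ {u v} → u ≤K v → NonNegK (v -K u)
  ≤K⇒NonNegK {u} {v} (inj₁ refl) = inj₁ (x-K-x≡0K u)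
  ≤K⇒NonNegK (inj₂ v-u>0) = inj₂ v-u>0

  NonNegK-antisym : ∀ z → NonNegK z → NonNegK (-K z) → z ≡ 0K
  NonNegK-antisym z (inj₁ z≡0) _ = z≡0
  NonNegK-antisym z (inj₂ _) (inj₁ -z≡0) = trans (sym (-K-involutive z)) (cong -K_ -z≡0)
  NonNegK-antisym z (inj₂ z>0) (inj₂ -z>0) = ⊥-elim (PosK-antisym z z>0 -z>0)

  NonNegK-scale : ∀ {q} z → 0ℚ ℚ.< q → NonNegK z → NonNegK (emb q *K z)
  NonNegK-scale {q} z _ (inj₁ refl) = inj₁ (*K-zeroʳ (emb q))
  NonNegK-scale z 0<q (inj₂ z>0) = inj₂ (PosK-scale z 0<q z>0)

  private
    nonzero-NonNegK⇒PosK : ∀ {r w} → r ≢ 0ℚ → w ≢ 0K → NonNegK (emb r *K w) → PosK (emb r *K w)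
    nonzero-NonNegK⇒PosK {r} {w} r≢0 w≢0 (inj₁ rw≡0) = ⊥-elim ([ r≢0 , w≢0 ]′ (emb-*K≡0 r w rw≡0))
    nonzero-NonNegK⇒PosK _ _ (inj₂ rw>0) = rw>0

    opposite-signs : ∀ {r r′ w} → 0ℚ ℚ.< r → r′ ℚ.< 0ℚ → w ≢ 0K →
                     NonNegK (emb r *K w) → ¬ NonNegK (emb r′ *K w)
    opposite-signs {r} {r′} {w} 0<r r′<0 w≢0 rw≥0 r′w≥0 =
      PosK-antisym (emb (- r′) *K (emb r *K w)) -r′rw>0 (subst PosK rr′w≡-[-r′rw] rr′w>0)
      where
      rw>0 : PosK (emb r *K w)
      rw>0 = nonzero-NonNegK⇒PosK (ℚP.<⇒≢ 0<r ∘ sym) w≢0 rw≥0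
      r′w>0 : PosK (emb r′ *K w)
      r′w>0 = nonzero-NonNegK⇒PosK (ℚP.<⇒≢ r′<0) w≢0 r′w≥0
      -r′rw>0 : PosK (emb (- r′) *K (emb r *K w))
      -r′rw>0 = PosK-scale (emb r *K w) (ℚP.neg-antimono-< r′<0) rw>0
      rr′w>0 : PosK (emb r *K (emb r′ *K w))
      rr′w>0 = PosK-scale (emb r′ *K w) 0<r r′w>0
      rr′w≡-[-r′rw] : emb r *K (emb r′ *K w) ≡ -K (emb (- r′) *K (emb r *K w))
      rr′w≡-[-r′rw] = solve 3 (λ A B w → A :* (B :* w) := :- ((:- B) :* (A :* w))) refl (emb r) (emb r′) w
        where open KSolver

  sign-lemma : ∀ {w} r r′ → w ≢ 0K → NonNegK (emb r *K w) → NonNegK (emb r′ *K w) → 0ℚ ≤ r * r′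
  sign-lemma r r′ w≢0 rw≥0 r′w≥0 = by-signs (ℚP.<-cmp r 0ℚ) (ℚP.<-cmp r′ 0ℚ)
    where
    by-signs : Tri (r ℚ.< 0ℚ) (r ≡ 0ℚ) (0ℚ ℚ.< r) → Tri (r′ ℚ.< 0ℚ) (r′ ≡ 0ℚ) (0ℚ ℚ.< r′) → 0ℚ ≤ r * r′
    by-signs (tri≈ _ r≡0 _) _ = ℚP.≤-reflexive (sym (trans (cong (_* r′) r≡0) (ℚP.*-zeroˡ r′)))
    by-signs _ (tri≈ _ r′≡0 _) = ℚP.≤-reflexive (sym (trans (cong (r *_) r′≡0) (ℚP.*-zeroʳ r)))
    by-signs (tri< r<0 _ _) (tri< r′<0 _ _) = ℚP.<⇒≤ (neg*neg>0 r<0 r′<0)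
    by-signs (tri> _ _ 0<r) (tri> _ _ 0<r′) = ℚP.<⇒≤ (*-pos 0<r 0<r′)
    by-signs (tri> _ _ 0<r) (tri< r′<0 _ _) = ⊥-elim (opposite-signs 0<r r′<0 w≢0 rw≥0 r′w≥0)
    by-signs (tri< r<0 _ _) (tri> _ _ 0<r′) = ⊥-elim (opposite-signs 0<r′ r<0 w≢0 r′w≥0 rw≥0)

  -- Multiplying by t² turns L ∓ 2c into rational multiples of L, so only scaling by positive
  -- rationals is needed.
  proportional⇒bound : ∀ {L c ab t} → L ≢ 0K → c *K emb t ≡ L *K emb ab →
                       (-K L) ≤K (two *K c) → (two *K c) ≤K L →
                       4ℚ * (ab * ab) ≤ t * t
  proportional⇒bound {L} {c} {ab} {t} L≢0 ct≡Lab -L≤2c 2c≤L = by-t (t ℚP.≟ 0ℚ)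
    where
    open ≡-Reasoning
    open KSolver using (solve; _:+_; _:*_; _:-_; _:=_; :-_; con)
    E A : K
    E = emb t
    A = emb ab
    by-t : Dec (t ≡ 0ℚ) → 4ℚ * (ab * ab) ≤ t * t
    by-t (yes t≡0) = subst₂ (λ u v → 4ℚ * (u * u) ≤ v * v) (sym ab≡0) (sym t≡0) ℚP.≤-refl
      where
      ab·L≡0 : emb ab *K L ≡ 0K
      ab·L≡0 = begin
        emb ab *K L  ≡⟨ *K-comm (emb ab) L ⟩
        L *K emb ab  ≡⟨ ct≡Lab ⟨
        c *K emb t   ≡⟨ cong (λ u → c *K emb u) t≡0 ⟩
        c *K 0K      ≡⟨ *K-zeroʳ c ⟩
        0K           ∎
      ab≡0 : ab ≡ 0ℚ
      ab≡0 = [ (λ h → h) , (λ L≡0 → ⊥-elim (L≢0 L≡0)) ]′ (emb-*K≡0 ab L ab·L≡0)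
    by-t (no t≢0) = square-bound t ab t≢0
      (sign-lemma r₋ r₊ L≢0 (scale-by-t² (L -K (two *K c)) r₋ lower-form (≤K⇒NonNegK 2c≤L))
                             (scale-by-t² ((two *K c) -K (-K L)) r₊ upper-form (≤K⇒NonNegK -L≤2c)))
      where
      r₋ r₊ : ℚ
      r₋ = t * (t - 2ℚ * ab)
      r₊ = t * (t + 2ℚ * ab)
      scale-by-t² : ∀ u r → emb (t * t) *K u ≡ emb r *K L → NonNegK u → NonNegK (emb r *K L)
      scale-by-t² u r eq u≥0 = subst NonNegK eq (NonNegK-scale u (square-pos t t≢0) u≥0)
      lower-form : emb (t * t) *K (L -K (two *K c)) ≡ emb r₋ *K L
      lower-form = begin
        emb (t * t) *K (L -K (two *K c))
          ≡⟨ cong (_*K (L -K (two *K c))) (emb-* t t) ⟨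
        (E *K E) *K (L -K (two *K c))
          ≡⟨ solve 3 (λ E L c → (E :* E) :* (L :- (con (+ 2) :* c)) := (E :* (E :* L)) :- (con (+ 2) :* (E :* (c :* E)))) refl E L c ⟩
        (E *K (E *K L)) -K (two *K (E *K (c *K E)))
          ≡⟨ cong (λ u → (E *K (E *K L)) -K (two *K (E *K u))) ct≡Lab ⟩
        (E *K (E *K L)) -K (two *K (E *K (L *K A)))
          ≡⟨ solve 3 (λ E L A → (E :* (E :* L)) :- (con (+ 2) :* (E :* (L :* A))) := (E :* (E :- (con (+ 2) :* A))) :* L) refl E L A ⟩
        (E *K (E -K (two *K A))) *K L
          ≡⟨ cong (λ u → (E *K (E -K u)) *K L) (emb-* 2ℚ ab) ⟩
        (E *K emb (t - 2ℚ * ab)) *K L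
          ≡⟨ cong (_*K L) (emb-* t (t - 2ℚ * ab)) ⟩
        emb r₋ *K L ∎
      upper-form : emb (t * t) *K ((two *K c) -K (-K L)) ≡ emb r₊ *K L
      upper-form = begin
        emb (t * t) *K ((two *K c) -K (-K L))
          ≡⟨ cong (_*K ((two *K c) -K (-K L))) (emb-* t t) ⟨
        (E *K E) *K ((two *K c) -K (-K L))
          ≡⟨ solve 3 (λ E L c → (E :* E) :* ((con (+ 2) :* c) :- (:- L)) := (E :* (E :* L)) :+ (con (+ 2) :* (E :* (c :* E)))) refl E L c ⟩
        (E *K (E *K L)) +K (two *K (E *K (c *K E)))
          ≡⟨ cong (λ u → (E *K (E *K L)) +K (two *K (E *K u))) ct≡Lab ⟩
        (E *K (E *K L)) +K (two *K (E *K (L *K A)))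
          ≡⟨ solve 3 (λ E L A → (E :* (E :* L)) :+ (con (+ 2) :* (E :* (L :* A))) := (E :* (E :+ (con (+ 2) :* A))) :* L) refl E L A ⟩
        (E *K (E +K (two *K A))) *K L
          ≡⟨ cong (λ u → (E *K (E +K u)) *K L) (emb-* 2ℚ ab) ⟩
        (E *K emb (t + 2ℚ * ab)) *K L
          ≡⟨ cong (_*K L) (emb-* t (t + 2ℚ * ab)) ⟩
        emb r₊ *K L ∎

  ω-cases : (∃[ q ] D ≡ 1 ℕ.+ q ℕ.* 4 × ω ≡ (½ , ½) × Δ ≡ Dℚ) ⊎ (ω ≡ (0ℚ , 1ℚ) × Δ ≡ 4ℚ * Dℚ)
  ω-cases with D ℕ.% 4 | ℕDM.m≡m%n+[m/n]*n D 4
  ... | 0           | _    = inj₂ (refl , refl)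
  ... | 1           | D≡1+ = inj₁ (D ℕ./ 4 , D≡1+ , refl , refl)
  ... | suc (suc _) | _    = inj₂ (refl , refl)

  Δ-cases : Δ ≡ Dℚ ⊎ Δ ≡ 4ℚ * Dℚ
  Δ-cases = [ (λ { (_ , _ , _ , Δ≡D) → inj₁ Δ≡D }) , (λ { (_ , Δ≡4D) → inj₂ Δ≡4D }) ]′ ω-cases

  1∈O : InO 1K
  1∈O = + 1 , + 0 , solve 1 (λ w → con (+ 1) := con (+ 1) :* con (+ 1) :+ con (+ 0) :* w) refl ω
    where open KSolver

  ω∈O : InO ω
  ω∈O = + 0 , + 1 , solve 1 (λ w → w := con (+ 0) :* con (+ 1) :+ con (+ 1) :* w) refl ω
    where open KSolver

  lin-lin : ∀ m n c e u w → lin m u n (lin c u e w) ≡ lin (m ℤ.+ n ℤ.* c) u (n ℤ.* e) w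
  lin-lin m n c e u w = begin
    lin m u n (lin c u e w)
      ≡⟨ solve 6 (λ M N C E u w → (M :* u) :+ (N :* ((C :* u) :+ (E :* w)))
                                := ((M :+ (N :* C)) :* u) :+ ((N :* E) :* w)) refl (intK m) (intK n) (intK c) (intK e) u w ⟩
    ((intK m +K (intK n *K intK c)) *K u) +K ((intK n *K intK e) *K w)
      ≡⟨ cong₂ (λ s t → (s *K u) +K (t *K w)) (trans (intK-+ m (n ℤ.* c)) (cong (intK m +K_) (intK-* n c))) (intK-* n e) ⟨
    lin (m ℤ.+ n ℤ.* c) u (n ℤ.* e) w ∎
    where
    open ≡-Reasoning
    open KSolver

  σω∈ℤ[ω] : ∃[ c ] ∃[ e ] σ ω ≡ lin c 1K e ω
  σω∈ℤ[ω] with ω-cases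
  ... | inj₁ (_ , _ , ω≡½+½√D , _) = + 1 , -1ℤ ,
    trans (subst (λ w → σ w ≡ 1K -K w) (sym ω≡½+½√D) refl)
          (solve 1 (λ w → con (+ 1) :- w := con (+ 1) :* con (+ 1) :+ con -1ℤ :* w) refl ω)
    where open KSolver
  ... | inj₂ (ω≡√D , _) = + 0 , -1ℤ ,
    trans (subst (λ w → σ w ≡ -K w) (sym ω≡√D) refl)
          (solve 1 (λ w → :- w := con (+ 0) :* con (+ 1) :+ con -1ℤ :* w) refl ω)
    where open KSolver

  ω²∈ℤ[ω] : ∃[ c ] ∃[ e ] ω *K ω ≡ lin c 1K e ω
  ω²∈ℤ[ω] with ω-cases
  ... | inj₁ (q , D≡1+4q , ω≡½+½√D , _) = + q , + 1 ,
    trans (subst (λ w → w *K w ≡ intK (+ q) +K w) (sym ω≡½+½√D) (cong₂ _,_ first-component refl))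
          (solve 2 (λ Q w → Q :+ w := Q :* con (+ 1) :+ con (+ 1) :* w) refl (intK (+ q)) ω)
    where
    open KSolver
    Dℚ≡1+4q : Dℚ ≡ 1ℚ + fromℕ q * 4ℚ
    Dℚ≡1+4q = trans (cong fromℕ D≡1+4q) (trans (fromℕ-+ 1 (q ℕ.* 4)) (cong (λ u → 1ℚ + u) (fromℕ-* q 4)))
    identity : ∀ Q → ½ * ½ + (1ℚ + Q * 4ℚ) * (½ * ½) ≡ Q + ½
    identity = solve-∀ ℚ-ring
    first-component : ½ * ½ + Dℚ * (½ * ½) ≡ fromℕ q + ½
    first-component = trans (cong (λ δ → ½ * ½ + δ * (½ * ½)) Dℚ≡1+4q) (identity (fromℕ q))
  ... | inj₂ (ω≡√D , _) = + D , + 0 ,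
    trans (subst (λ w → w *K w ≡ intK (+ D)) (sym ω≡√D) (cong₂ _,_ (identity Dℚ) refl))
          (solve 2 (λ Q w → Q := Q :* con (+ 1) :+ con (+ 0) :* w) refl (intK (+ D)) ω)
    where
    open KSolver
    identity : ∀ δ → 0ℚ * 0ℚ + δ * (1ℚ * 1ℚ) ≡ δ
    identity = solve-∀ ℚ-ring

  InO-σ : ∀ {z} → InO z → InO (σ z)
  InO-σ {z} (m , n , z≡m+nω) = m ℤ.+ n ℤ.* c , n ℤ.* e , (begin
    σ z                                 ≡⟨ cong σ z≡m+nω ⟩
    σ (lin m 1K n ω)                    ≡⟨ σ-lin m 1K n ω ⟩
    lin m 1K n (σ ω)                    ≡⟨ cong (lin m 1K n) σω≡c+eω ⟩
    lin m 1K n (lin c 1K e ω)           ≡⟨ lin-lin m n c e 1K ω ⟩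
    lin (m ℤ.+ n ℤ.* c) 1K (n ℤ.* e) ω  ∎)
    where
    open ≡-Reasoning
    c e : ℤ
    c = proj₁ σω∈ℤ[ω]
    e = proj₁ (proj₂ σω∈ℤ[ω])
    σω≡c+eω : σ ω ≡ lin c 1K e ω
    σω≡c+eω = proj₂ (proj₂ σω∈ℤ[ω])

  lin-1ω-* : ∀ {c e} → ω *K ω ≡ lin c 1K e ω → ∀ m n m′ n′ →
             lin m 1K n ω *K lin m′ 1K n′ ω
             ≡ lin (m ℤ.* m′ ℤ.+ n ℤ.* n′ ℤ.* c) 1K (m ℤ.* n′ ℤ.+ n ℤ.* m′ ℤ.+ n ℤ.* n′ ℤ.* e) ω
  lin-1ω-* {c} {e} ω²≡c+eω m n m′ n′ = begin
    lin m 1K n ω *K lin m′ 1K n′ ω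
      ≡⟨ solve 5 (λ A B A′ B′ w → ((A :* con (+ 1)) :+ (B :* w)) :* ((A′ :* con (+ 1)) :+ (B′ :* w))
           := (((A :* A′) :* con (+ 1)) :+ (((A :* B′) :+ (B :* A′)) :* w)) :+ ((B :* B′) :* (w :* w))) refl A B A′ B′ ω ⟩
    (((A *K A′) *K 1K) +K (((A *K B′) +K (B *K A′)) *K ω)) +K ((B *K B′) *K (ω *K ω))
      ≡⟨ cong (λ t → (((A *K A′) *K 1K) +K (((A *K B′) +K (B *K A′)) *K ω)) +K ((B *K B′) *K t)) ω²≡c+eω ⟩
    (((A *K A′) *K 1K) +K (((A *K B′) +K (B *K A′)) *K ω)) +K ((B *K B′) *K lin c 1K e ω)
      ≡⟨ solve 7 (λ A B A′ B′ C E w →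
             (((A :* A′) :* con (+ 1)) :+ (((A :* B′) :+ (B :* A′)) :* w)) :+ ((B :* B′) :* ((C :* con (+ 1)) :+ (E :* w)))
          := (((A :* A′) :+ ((B :* B′) :* C)) :* con (+ 1)) :+ ((((A :* B′) :+ (B :* A′)) :+ ((B :* B′) :* E)) :* w))
           refl A B A′ B′ (intK c) (intK e) ω ⟩
    (((A *K A′) +K ((B *K B′) *K intK c)) *K 1K) +K ((((A *K B′) +K (B *K A′)) +K ((B *K B′) *K intK e)) *K ω)
      ≡⟨ cong₂ (λ s t → (s *K 1K) +K (t *K ω)) constant-coefficient ω-coefficient ⟨
    lin (m ℤ.* m′ ℤ.+ n ℤ.* n′ ℤ.* c) 1K (m ℤ.* n′ ℤ.+ n ℤ.* m′ ℤ.+ n ℤ.* n′ ℤ.* e) ω ∎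
    where
    open ≡-Reasoning
    open KSolver using (solve; _:+_; _:*_; _:=_; con)
    A B A′ B′ : K
    A = intK m
    B = intK n
    A′ = intK m′
    B′ = intK n′
    intK-** : ∀ i j k → intK (i ℤ.* j ℤ.* k) ≡ (intK i *K intK j) *K intK k
    intK-** i j k = trans (intK-* (i ℤ.* j) k) (cong (_*K intK k) (intK-* i j))
    constant-coefficient : intK (m ℤ.* m′ ℤ.+ n ℤ.* n′ ℤ.* c) ≡ (A *K A′) +K ((B *K B′) *K intK c)
    constant-coefficient = trans (intK-+ (m ℤ.* m′) _) (cong₂ _+K_ (intK-* m m′) (intK-** n n′ c))
    ω-coefficient : intK (m ℤ.* n′ ℤ.+ n ℤ.* m′ ℤ.+ n ℤ.* n′ ℤ.* e) ≡ ((A *K B′) +K (B *K A′)) +K ((B *K B′) *K intK e)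
    ω-coefficient = trans (intK-+ (m ℤ.* n′ ℤ.+ n ℤ.* m′) _)
      (cong₂ _+K_ (trans (intK-+ (m ℤ.* n′) _) (cong₂ _+K_ (intK-* m n′) (intK-* n m′))) (intK-** n n′ e))

  InO-* : ∀ {z z′} → InO z → InO z′ → InO (z *K z′)
  InO-* (m , n , z≡m+nω) (m′ , n′ , z′≡m′+n′ω) =
    m ℤ.* m′ ℤ.+ n ℤ.* n′ ℤ.* c , m ℤ.* n′ ℤ.+ n ℤ.* m′ ℤ.+ n ℤ.* n′ ℤ.* e ,
    trans (cong₂ _*K_ z≡m+nω z′≡m′+n′ω) (lin-1ω-* ω²≡c+eω m n m′ n′)
    where
    c e : ℤ
    c = proj₁ ω²∈ℤ[ω]
    e = proj₁ (proj₂ ω²∈ℤ[ω])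
    ω²≡c+eω : ω *K ω ≡ lin c 1K e ω
    ω²≡c+eω = proj₂ (proj₂ ω²∈ℤ[ω])

  det-lin : ∀ a b c e u v → det (lin a u b v) (lin c u e v) ≡ intK (a ℤ.* e ℤ.- b ℤ.* c) *K det u v
  det-lin a b c e u v = begin
    det (lin a u b v) (lin c u e v)
      ≡⟨ cong₂ (λ s t → (lin a u b v *K s) -K (t *K lin c u e v)) (σ-lin c u e v) (σ-lin a u b v) ⟩
    (lin a u b v *K lin c (σ u) e (σ v)) -K (lin a (σ u) b (σ v) *K lin c u e v)
      ≡⟨ solve 8 (λ A B C E u su v sv →
           ((A :* u :+ B :* v) :* (C :* su :+ E :* sv)) :- ((A :* su :+ B :* sv) :* (C :* u :+ E :* v))
           := ((A :* E) :- (B :* C)) :* ((u :* sv) :- (su :* v))) refl (intK a) (intK b) (intK c) (intK e) u (σ u) v (σ v) ⟩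
    ((intK a *K intK e) -K (intK b *K intK c)) *K det u v
      ≡⟨ cong (_*K det u v) intK-det ⟨
    intK (a ℤ.* e ℤ.- b ℤ.* c) *K det u v ∎
    where
    open ≡-Reasoning
    open KSolver using (solve; _:+_; _:*_; _:-_; _:=_)
    intK-det : intK (a ℤ.* e ℤ.- b ℤ.* c) ≡ (intK a *K intK e) -K (intK b *K intK c)
    intK-det = trans (intK-+ (a ℤ.* e) (ℤ.- (b ℤ.* c)))
                     (cong₂ _+K_ (intK-* a e) (trans (intK-neg (b ℤ.* c)) (cong -K_ (intK-* b c))))

  det-1ω² : det 1K ω *K det 1K ω ≡ emb Δ
  det-1ω² = [ case-½+½√D , case-√D ]′ ω-cases
    where
    det-1 : ∀ w → det 1K w ≡ σ w -K w
    det-1 w = solve 2 (λ w σw → (con (+ 1) :* σw) :- (con (+ 1) :* w) := σw :- w) refl w (σ w)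
      where open KSolver
    square-√D-multiple : ∀ c → (0ℚ , c) *K (0ℚ , c) ≡ emb (Dℚ * (c * c))
    square-√D-multiple c = cong₂ _,_
      (solve 2 (λ c δ → con 0ℚ :* con 0ℚ :+ δ :* (c :* c) := δ :* (c :* c)) refl c Dℚ)
      (solve 1 (λ c → con 0ℚ :* c :+ c :* con 0ℚ := con 0ℚ) refl c)
      where open ℚSolver.+-*-Solver
    det-1-square : ∀ {c} → det 1K ω ≡ (0ℚ , c) → det 1K ω *K det 1K ω ≡ emb (Dℚ * (c * c))
    det-1-square {c} eq = trans (cong (λ d → d *K d) eq) (square-√D-multiple c)
    case-½+½√D : (∃[ q ] D ≡ 1 ℕ.+ q ℕ.* 4 × ω ≡ (½ , ½) × Δ ≡ Dℚ) → det 1K ω *K det 1K ω ≡ emb Δ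
    case-½+½√D (_ , _ , ω≡½+½√D , Δ≡D) =
      trans (det-1-square (trans (det-1 ω) (subst (λ w → σ w -K w ≡ (0ℚ , - 1ℚ)) (sym ω≡½+½√D) refl)))
            (cong emb (trans (ℚP.*-identityʳ Dℚ) (sym Δ≡D)))
    case-√D : (ω ≡ (0ℚ , 1ℚ) × Δ ≡ 4ℚ * Dℚ) → det 1K ω *K det 1K ω ≡ emb Δ
    case-√D (ω≡√D , Δ≡4D) =
      trans (det-1-square (trans (det-1 ω) (subst (λ w → σ w -K w ≡ (0ℚ , - 2ℚ)) (sym ω≡√D) refl)))
            (cong emb (trans (ℚP.*-comm Dℚ _) (sym Δ≡4D)))

module RealQuadraticField (D : ℕ) (1<D : 1 ℕ.< D) (sqf : SquareFree D) where
  open QF D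
  open QuadraticField D

  Dℚ≢0 : Dℚ ≢ 0ℚ
  Dℚ≢0 Dℚ≡0 = ℕP.<⇒≢ (ℕP.<-trans (ℕ.s≤s ℕ.z≤n) 1<D) (sym (ℤP.+-injective (fromℤ-injective Dℚ≡0)))

  Δ≢0 : Δ ≢ 0ℚ
  Δ≢0 Δ≡0 = [ (λ Δ≡D → Dℚ≢0 (trans (sym Δ≡D) Δ≡0))
            , (λ Δ≡4D → [ (λ ()) , Dℚ≢0 ]′ (p*q≡0⇒p≡0∨q≡0 4ℚ Dℚ (trans (sym Δ≡4D) Δ≡0))) ]′ Δ-cases

  Δ-non-square : ∀ q → q * q ≢ Δ
  Δ-non-square q q²≡Δ = [ (λ Δ≡D → ℚP.1≢0 (irrational 1ℚ (trans (ℚP.*-identityʳ Dℚ) (sym Δ≡D))))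
                        , (λ Δ≡4D → 2≢0 (irrational 2ℚ (trans (ℚP.*-comm Dℚ 4ℚ) (sym Δ≡4D)))) ]′ Δ-cases
    where
    2≢0 : 2ℚ ≢ 0ℚ
    2≢0 ()
    irrational : ∀ c → Dℚ * (c * c) ≡ Δ → c ≡ 0ℚ
    irrational c D[c²]≡Δ = square-free⇒non-squareℚ sqf 1<D q c (trans q²≡Δ (sym D[c²]≡Δ))

  N≡0⇒≡0K : ∀ z → N z ≡ 0ℚ → z ≡ 0K
  N≡0⇒≡0K (a , b) N≡0 = cong₂ _,_ a≡0 b≡0
    where
    a²≡Db² : a * a ≡ Dℚ * (b * b)
    a²≡Db² = p-q≡0⇒p≡q N≡0
    b≡0 : b ≡ 0ℚ
    b≡0 = square-free⇒non-squareℚ sqf 1<D a b a²≡Db²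
    a≡0 : a ≡ 0ℚ
    a≡0 = [ (λ h → h) , (λ h → h) ]′ (p*q≡0⇒p≡0∨q≡0 a a (begin
      a * a           ≡⟨ a²≡Db² ⟩
      Dℚ * (b * b)    ≡⟨ cong (λ c → Dℚ * (c * c)) b≡0 ⟩
      Dℚ * (0ℚ * 0ℚ)  ≡⟨ ℚP.*-zeroʳ Dℚ ⟩
      0ℚ              ∎))
      where open ≡-Reasoning

  K-integral : ∀ z w → z *K w ≡ 0K → z ≡ 0K ⊎ w ≡ 0K
  K-integral z w zw≡0 = [ inj₂ ∘ N≡0⇒≡0K w , inj₁ ]′ (emb-*K≡0 (N w) z Nw·z≡0)
    where
    open ≡-Reasoning
    Nw·z≡0 : emb (N w) *K z ≡ 0K
    Nw·z≡0 = begin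
      emb (N w) *K z   ≡⟨ cong (_*K z) (*K-σ≡N w) ⟨
      (w *K σ w) *K z  ≡⟨ solve 3 (λ w σw z → (w :* σw) :* z := (z :* w) :* σw) refl w (σ w) z ⟩
      (z *K w) *K σ w  ≡⟨ cong (_*K σ w) zw≡0 ⟩
      0K *K σ w        ≡⟨ *K-zeroˡ (σ w) ⟩
      0K               ∎
      where open KSolver

  square≡Δ⇒≢0K : ∀ {z} → z *K z ≡ emb Δ → z ≢ 0K
  square≡Δ⇒≢0K {z} z²≡Δ refl = Δ≢0 (emb-injective (trans (sym z²≡Δ) (*K-zeroˡ 0K)))

  basis⇒≢0K : ∀ {x y} → IsZBasis x y → x ≢ 0K
  basis⇒≢0K {y = y} (_ , independent) refl = 0≢1 (proj₁ (independent (+ 0) (+ 0) (+ 1) (+ 0)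
    (solve 1 (λ y → con (+ 0) :* con (+ 0) :+ con (+ 0) :* y := con (+ 1) :* con (+ 0) :+ con (+ 0) :* y) refl y)))
    where
    open KSolver
    0≢1 : + 0 ≢ + 1
    0≢1 ()

  scaling-invertible : ∀ {u} k k′ → u ≢ 0K → u ≡ intK k′ *K (intK k *K u) → k′ ℤ.* k ≡ + 1
  scaling-invertible {u} k k′ u≢0 u≡k′ku = ℤP.i-j≡0⇒i≡j (k′ ℤ.* k) (+ 1)
    (fromℤ-injective ([ (λ h → h) , (λ u≡0 → ⊥-elim (u≢0 u≡0)) ]′ (emb-*K≡0 _ u [k′k-1]u≡0)))
    where
    open ≡-Reasoning
    [k′k-1]u≡0 : intK (k′ ℤ.* k ℤ.- + 1) *K u ≡ 0K
    [k′k-1]u≡0 = begin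
      intK (k′ ℤ.* k ℤ.- + 1) *K u
        ≡⟨ cong (_*K u) (trans (intK-+ (k′ ℤ.* k) -1ℤ) (cong (_+K intK -1ℤ) (intK-* k′ k))) ⟩
      ((intK k′ *K intK k) +K intK -1ℤ) *K u
        ≡⟨ solve 3 (λ A B u → ((A :* B) :+ con -1ℤ) :* u := A :* (B :* u) :- u) refl (intK k′) (intK k) u ⟩
      (intK k′ *K (intK k *K u)) -K u  ≡⟨ cong (_-K u) u≡k′ku ⟨
      u -K u                           ≡⟨ x-K-x≡0K u ⟩
      0K                               ∎
      where open KSolver

  basis-det² : ∀ {x y} → InO x → InO y → IsZBasis x y → det x y *K det x y ≡ emb Δ
  basis-det² {x} {y} (m , n , x≡m+nω) (m′ , n′ , y≡m′+n′ω) (spans , _) = begin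
    det x y *K det x y                         ≡⟨ cong (λ d → d *K d) det-xy ⟩
    (intK k *K det 1K ω) *K (intK k *K det 1K ω)
      ≡⟨ solve 2 (λ A d → (A :* d) :* (A :* d) := (A :* A) :* (d :* d)) refl (intK k) (det 1K ω) ⟩
    (intK k *K intK k) *K (det 1K ω *K det 1K ω)  ≡⟨ cong₂ _*K_ k²≡1 det-1ω² ⟩
    1K *K emb Δ                                   ≡⟨ *K-identityˡ (emb Δ) ⟩
    emb Δ                                         ∎
    where
    open ≡-Reasoning
    open KSolver using (solve; _:*_; _:=_)
    p q p′ q′ : ℤ
    p = proj₁ (spans (1K , 1∈O))
    q = proj₁ (proj₂ (spans (1K , 1∈O)))
    p′ = proj₁ (spans (ω , ω∈O))
    q′ = proj₁ (proj₂ (spans (ω , ω∈O)))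
    k k′ : ℤ
    k = m ℤ.* n′ ℤ.- n ℤ.* m′
    k′ = p ℤ.* q′ ℤ.- q ℤ.* p′
    det-xy : det x y ≡ intK k *K det 1K ω
    det-xy = trans (cong₂ det x≡m+nω y≡m′+n′ω) (det-lin m n m′ n′ 1K ω)
    det-1ω : det 1K ω ≡ intK k′ *K det x y
    det-1ω = trans (cong₂ det (proj₂ (proj₂ (spans (1K , 1∈O)))) (proj₂ (proj₂ (spans (ω , ω∈O))))) (det-lin p q p′ q′ x y)
    k′k≡1 : k′ ℤ.* k ≡ + 1
    k′k≡1 = scaling-invertible k k′ (square≡Δ⇒≢0K det-1ω²) (trans det-1ω (cong (intK k′ *K_) det-xy))
    k²≡1 : intK k *K intK k ≡ 1K
    k²≡1 = trans (sym (intK-* k k)) (cong intK (unit*unit≡1 (i*j≡1⇒unit k k′ (trans (ℤP.*-comm k k′) k′k≡1))))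

  basis-det≢0K : ∀ {x y} → InO x → InO y → IsZBasis x y → det x y ≢ 0K
  basis-det≢0K x∈O y∈O basis = square≡Δ⇒≢0K (basis-det² x∈O y∈O basis)

  basis-change : ∀ {x y y′} → InO y → InO y′ → IsZBasis x y → IsZBasis x y′ →
                 ∃[ m ] ∃[ n ] y′ ≡ lin m x n y × Unitℤ n
  basis-change {x} {y} {y′} y∈O y′∈O (spans , independent) (spans′ , _) = m , n , y′≡mx+ny , n-unit
    where
    m n m′ n′ : ℤ
    m = proj₁ (spans (y′ , y′∈O))
    n = proj₁ (proj₂ (spans (y′ , y′∈O)))
    y′≡mx+ny : y′ ≡ lin m x n y
    y′≡mx+ny = proj₂ (proj₂ (spans (y′ , y′∈O)))
    m′ = proj₁ (spans′ (y , y∈O))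
    n′ = proj₁ (proj₂ (spans′ (y , y∈O)))
    y≡m′x+n′y′ : y ≡ lin m′ x n′ y′
    y≡m′x+n′y′ = proj₂ (proj₂ (spans′ (y , y∈O)))
    y-twice : lin (m′ ℤ.+ n′ ℤ.* m) x (n′ ℤ.* n) y ≡ lin (+ 0) x (+ 1) y
    y-twice = begin
      lin (m′ ℤ.+ n′ ℤ.* m) x (n′ ℤ.* n) y  ≡⟨ lin-lin m′ n′ m n x y ⟨
      lin m′ x n′ (lin m x n y)             ≡⟨ cong (lin m′ x n′) y′≡mx+ny ⟨
      lin m′ x n′ y′                        ≡⟨ y≡m′x+n′y′ ⟨
      y                                     ≡⟨ solve 2 (λ x y → y := con (+ 0) :* x :+ con (+ 1) :* y) refl x y ⟩
      lin (+ 0) x (+ 1) y                   ∎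
      where
      open ≡-Reasoning
      open KSolver
    n-unit : Unitℤ n
    n-unit = i*j≡1⇒unit n n′ (trans (ℤP.*-comm n n′)
               (proj₂ (independent (m′ ℤ.+ n′ ℤ.* m) (n′ ℤ.* n) (+ 0) (+ 1) y-twice)))

  σ-stable⇒norm-one : ∀ {x r} → x ≢ 0K → σ x ≡ x *K r → r *K σ r ≡ 1K
  σ-stable⇒norm-one {x} {r} x≢0 σx≡xr = trans (*K-σ≡N r) (cong emb Nr≡1)
    where
    open ≡-Reasoning
    x≡xrσr : x ≡ x *K (r *K σ r)
    x≡xrσr = begin
      x                ≡⟨ σ-involutive x ⟨
      σ (σ x)          ≡⟨ cong σ σx≡xr ⟩
      σ (x *K r)       ≡⟨ σ-* x r ⟩
      σ x *K σ r       ≡⟨ cong (_*K σ r) σx≡xr ⟩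
      (x *K r) *K σ r  ≡⟨ *K-assoc x r (σ r) ⟩
      x *K (r *K σ r)  ∎
    [1-Nr]x≡0 : emb (1ℚ - N r) *K x ≡ 0K
    [1-Nr]x≡0 = begin
      (1K -K emb (N r)) *K x   ≡⟨ cong (λ t → (1K -K t) *K x) (*K-σ≡N r) ⟨
      (1K -K (r *K σ r)) *K x  ≡⟨ solve 2 (λ x u → (con (+ 1) :- u) :* x := x :- x :* u) refl x (r *K σ r) ⟩
      x -K (x *K (r *K σ r))   ≡⟨ cong (λ t → x -K t) x≡xrσr ⟨
      x -K x                   ≡⟨ x-K-x≡0K x ⟩
      0K                       ∎
      where open KSolver
    Nr≡1 : N r ≡ 1ℚ
    Nr≡1 = sym (p-q≡0⇒p≡q ([ (λ h → h) , ⊥-elim ∘ x≢0 ]′ (emb-*K≡0 (1ℚ - N r) x [1-Nr]x≡0)))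

  σ-stable-conjugate : ∀ {x y r} → InO y → IsZBasis x y → InO r → σ x ≡ x *K r →
                       ∃[ m ] ∃[ n ] σ y ≡ r *K lin m x n y × Unitℤ n
  σ-stable-conjugate {x} {y} {r} y∈O basis@(spans , independent) r∈O σx≡xr = m , n , σy≡r[mx+ny] , n-unit
    where
    open ≡-Reasoning
    rσr≡1 : r *K σ r ≡ 1K
    rσr≡1 = σ-stable⇒norm-one (basis⇒≢0K basis) σx≡xr
    σ[ry]∈O : InO (σ (r *K y))
    σ[ry]∈O = InO-σ (InO-* r∈O y∈O)
    m n : ℤ
    m = proj₁ (spans (σ (r *K y) , σ[ry]∈O))
    n = proj₁ (proj₂ (spans (σ (r *K y) , σ[ry]∈O)))
    σ[ry]≡mx+ny : σ (r *K y) ≡ lin m x n y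
    σ[ry]≡mx+ny = proj₂ (proj₂ (spans (σ (r *K y) , σ[ry]∈O)))
    σy≡r[mx+ny] : σ y ≡ r *K lin m x n y
    σy≡r[mx+ny] = begin
      σ y                ≡⟨ *K-identityˡ (σ y) ⟨
      1K *K σ y          ≡⟨ cong (_*K σ y) rσr≡1 ⟨
      (r *K σ r) *K σ y  ≡⟨ *K-assoc r (σ r) (σ y) ⟩
      r *K (σ r *K σ y)  ≡⟨ cong (r *K_) (σ-* r y) ⟨
      r *K σ (r *K y)    ≡⟨ cong (r *K_) σ[ry]≡mx+ny ⟩
      r *K lin m x n y   ∎
    ry≡mxr+nσy : r *K y ≡ lin m (x *K r) n (σ y)
    ry≡mxr+nσy = begin
      r *K y                  ≡⟨ σ-involutive (r *K y) ⟨
      σ (σ (r *K y))          ≡⟨ cong σ σ[ry]≡mx+ny ⟩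
      σ (lin m x n y)         ≡⟨ σ-lin m x n y ⟩
      lin m (σ x) n (σ y)     ≡⟨ cong (λ t → lin m t n (σ y)) σx≡xr ⟩
      lin m (x *K r) n (σ y)  ∎
    A B : K
    A = intK m
    B = intK n
    -- Applying σ to σ(r y) = m x + n y and using r σ(r) = 1 gives (m + n m) x + (n² − 1) y = 0.
    W : K
    W = ((A +K (B *K A)) *K x) +K (((B *K B) -K 1K) *K y)
    r[W]≡0 : r *K W ≡ 0K
    r[W]≡0 = begin
      r *K (((A +K (B *K A)) *K x) +K (((B *K B) -K 1K) *K y))
        ≡⟨ solve 6 (λ r x y σy A B → r :* (((A :+ (B :* A)) :* x) :+ (((B :* B) :- con (+ 1)) :* y))
                  := :- (((r :* y) :- ((A :* (x :* r)) :+ (B :* σy))) :+ (B :* (σy :- (r :* ((A :* x) :+ (B :* y)))))))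
             refl r x y (σ y) A B ⟩
      -K (((r *K y) -K lin m (x *K r) n (σ y)) +K (B *K (σ y -K (r *K lin m x n y))))
        ≡⟨ cong₂ (λ s t → -K (s +K (B *K t)))
             (trans (cong (_-K lin m (x *K r) n (σ y)) ry≡mxr+nσy) (x-K-x≡0K (lin m (x *K r) n (σ y))))
             (trans (cong (_-K (r *K lin m x n y)) σy≡r[mx+ny]) (x-K-x≡0K (r *K lin m x n y))) ⟩
      -K (0K +K (B *K 0K))
        ≡⟨ solve 1 (λ B → :- (con (+ 0) :+ (B :* con (+ 0))) := con (+ 0)) refl B ⟩
      0K ∎
      where open KSolver
    W≡0 : lin (m ℤ.+ n ℤ.* m) x (n ℤ.* n ℤ.- + 1) y ≡ lin (+ 0) x (+ 0) y
    W≡0 = begin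
      lin (m ℤ.+ n ℤ.* m) x (n ℤ.* n ℤ.- + 1) y
        ≡⟨ cong₂ (λ s t → (s *K x) +K (t *K y))
             (trans (intK-+ m (n ℤ.* m)) (cong (A +K_) (intK-* n m)))
             (trans (intK-+ (n ℤ.* n) -1ℤ) (cong (_+K intK -1ℤ) (intK-* n n))) ⟩
      W                    ≡⟨ *K-identityˡ W ⟨
      1K *K W              ≡⟨ cong (_*K W) (trans (*K-comm (σ r) r) rσr≡1) ⟨
      (σ r *K r) *K W      ≡⟨ *K-assoc (σ r) r W ⟩
      σ r *K (r *K W)      ≡⟨ cong (σ r *K_) r[W]≡0 ⟩
      σ r *K 0K            ≡⟨ *K-zeroʳ (σ r) ⟩
      0K                   ≡⟨ solve 2 (λ x y → con (+ 0) := con (+ 0) :* x :+ con (+ 0) :* y) refl x y ⟩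
      lin (+ 0) x (+ 0) y  ∎
      where open KSolver
    n-unit : Unitℤ n
    n-unit = i*j≡1⇒unit n n (ℤP.i-j≡0⇒i≡j (n ℤ.* n) (+ 1)
               (proj₂ (independent (m ℤ.+ n ℤ.* m) (n ℤ.* n ℤ.- + 1) (+ 0) (+ 0) W≡0)))

  trace-multiple : ∀ {x y r} → InO x → InO y → IsZBasis x y → InO r → σ x ≡ x *K r →
                   ∃[ k ] trace x y ≡ intK k *K (x *K σ x)
  trace-multiple {x} {y} {r} x∈O y∈O basis r∈O σx≡xr = by-sign (σ-stable-conjugate y∈O basis r∈O σx≡xr)
    where
    open ≡-Reasoning
    open KSolver using (solve; _:+_; _:*_; _:-_; _:=_; con)
    by-sign : (∃[ m ] ∃[ n ] σ y ≡ r *K lin m x n y × Unitℤ n) → ∃[ k ] trace x y ≡ intK k *K (x *K σ x)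
    -- n = 1 would make det x y = m N(x) a rational square root of Δ.
    by-sign (m , _ , σy≡r[mx+y] , inj₁ refl) = ⊥-elim (Δ-non-square (fromℤ m * N x) (emb-injective (begin
      emb (fromℤ m * N x * (fromℤ m * N x))       ≡⟨ emb-* (fromℤ m * N x) (fromℤ m * N x) ⟨
      emb (fromℤ m * N x) *K emb (fromℤ m * N x)  ≡⟨ cong (λ d → d *K d) det≡m·N ⟨
      det x y *K det x y                          ≡⟨ basis-det² x∈O y∈O basis ⟩
      emb Δ                                       ∎)))
      where
      det≡m·N : det x y ≡ emb (fromℤ m * N x)
      det≡m·N = begin
        (x *K σ y) -K (σ x *K y)                          ≡⟨ cong₂ (λ s t → (x *K s) -K (t *K y)) σy≡r[mx+y] σx≡xr ⟩
        (x *K (r *K lin m x (+ 1) y)) -K ((x *K r) *K y)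
          ≡⟨ solve 4 (λ x y r A → (x :* (r :* ((A :* x) :+ (con (+ 1) :* y)))) :- ((x :* r) :* y)
                               := A :* (x :* (x :* r))) refl x y r (intK m) ⟩
        intK m *K (x *K (x *K r))  ≡⟨ cong (λ t → intK m *K (x *K t)) σx≡xr ⟨
        intK m *K (x *K σ x)       ≡⟨ cong (intK m *K_) (*K-σ≡N x) ⟩
        intK m *K emb (N x)        ≡⟨ emb-* (fromℤ m) (N x) ⟩
        emb (fromℤ m * N x)        ∎
    by-sign (m , _ , σy≡r[mx-y] , inj₂ refl) = m , (begin
      (x *K σ y) +K (σ x *K y)                           ≡⟨ cong₂ (λ s t → (x *K s) +K (t *K y)) σy≡r[mx-y] σx≡xr ⟩
      (x *K (r *K lin m x -1ℤ y)) +K ((x *K r) *K y)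
        ≡⟨ solve 4 (λ x y r A → (x :* (r :* ((A :* x) :+ (con -1ℤ :* y)))) :+ ((x :* r) :* y)
                             := A :* (x :* (x :* r))) refl x y r (intK m) ⟩
      intK m *K (x *K (x *K r))  ≡⟨ cong (λ t → intK m *K (x *K t)) σx≡xr ⟨
      intK m *K (x *K σ x)       ∎)

  trace-square : ∀ {x y t} → InO x → InO y → IsZBasis x y → trace x y ≡ emb t →
                 t * t ≡ Δ + 4ℚ * (N x * N y)
  trace-square {x} {y} {t} x∈O y∈O basis trace≡t = emb-injective (begin
    emb (t * t)                                         ≡⟨ emb-* t t ⟨
    emb t *K emb t                                        ≡⟨ cong (λ z → z *K z) trace≡t ⟨
    trace x y *K trace x y
      ≡⟨ solve 4 (λ x σx y σy → ((x :* σy) :+ (σx :* y)) :* ((x :* σy) :+ (σx :* y))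
                  := (((x :* σy) :- (σx :* y)) :* ((x :* σy) :- (σx :* y))) :+ (con (+ 4) :* ((x :* σx) :* (y :* σy))))
           refl x (σ x) y (σ y) ⟩
    (det x y *K det x y) +K (intK (+ 4) *K ((x *K σ x) *K (y *K σ y)))
      ≡⟨ cong₂ (λ s t → s +K (intK (+ 4) *K t)) (basis-det² x∈O y∈O basis) (cong₂ _*K_ (*K-σ≡N x) (*K-σ≡N y)) ⟩
    emb Δ +K (intK (+ 4) *K (emb (N x) *K emb (N y)))
      ≡⟨ cong (λ s → emb Δ +K (intK (+ 4) *K s)) (emb-* (N x) (N y)) ⟩
    emb Δ +K (intK (+ 4) *K emb (N x * N y))
      ≡⟨ cong (emb Δ +K_) (emb-* 4ℚ (N x * N y)) ⟩
    emb (Δ + 4ℚ * (N x * N y))            ∎)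
    where
    open ≡-Reasoning
    open KSolver using (solve; _:+_; _:*_; _:-_; _:=_; con)

  trace-basis-change : ∀ x y k m n → trace x y ≡ intK k *K (x *K σ x) →
                       trace x (lin m x n y) ≡ intK (+ 2 ℤ.* m ℤ.+ n ℤ.* k) *K (x *K σ x)
  trace-basis-change x y k m n trace≡k·N = begin
    (x *K σ (lin m x n y)) +K (σ x *K lin m x n y)
      ≡⟨ cong (λ s → (x *K s) +K (σ x *K lin m x n y)) (σ-lin m x n y) ⟩
    (x *K lin m (σ x) n (σ y)) +K (σ x *K lin m x n y)
      ≡⟨ solve 6 (λ A B x σx y σy → (x :* ((A :* σx) :+ (B :* σy))) :+ (σx :* ((A :* x) :+ (B :* y)))
                  := ((con (+ 2) :* A) :* (x :* σx)) :+ (B :* ((x :* σy) :+ (σx :* y)))) refl (intK m) (intK n) x (σ x) y (σ y) ⟩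
    ((intK (+ 2) *K intK m) *K (x *K σ x)) +K (intK n *K trace x y)
      ≡⟨ cong (λ s → ((intK (+ 2) *K intK m) *K (x *K σ x)) +K (intK n *K s)) trace≡k·N ⟩
    ((intK (+ 2) *K intK m) *K (x *K σ x)) +K (intK n *K (intK k *K (x *K σ x)))
      ≡⟨ solve 4 (λ A B C Z → ((con (+ 2) :* A) :* Z) :+ (B :* (C :* Z)) := ((con (+ 2) :* A) :+ (B :* C)) :* Z)
           refl (intK m) (intK n) (intK k) (x *K σ x) ⟩
    ((intK (+ 2) *K intK m) +K (intK n *K intK k)) *K (x *K σ x)
      ≡⟨ cong (_*K (x *K σ x)) (trans (intK-+ (+ 2 ℤ.* m) (n ℤ.* k)) (cong₂ _+K_ (intK-* (+ 2) m) (intK-* n k))) ⟨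
    intK (+ 2 ℤ.* m ℤ.+ n ℤ.* k) *K (x *K σ x) ∎
    where
    open ≡-Reasoning
    open KSolver using (solve; _:+_; _:*_; _:=_; con)

  good⇒proportional : ∀ {x y s} → InO x → InO y → IsZBasis x y → sqN s x ≡ sqN s y →
                      ip s x y *K trace x y ≡ sqN s x *K ((x *K σ x) +K (y *K σ y))
  good⇒proportional {x} {y} {s} x∈O y∈O basis L≡L′ = [ cT≡LAB , e≡0⇒cT≡LAB ]′ (K-integral ((c *K T) -K (L *K AB)) e key)
    where
    open ≡-Reasoning
    open KSolver using (solve; _:+_; _:*_; _:-_; _:=_; con)
    L L′ c d T AB e : K
    L = sqN s x
    L′ = sqN s y
    c = ip s x y
    d = det x y
    T = trace x y
    AB = (x *K σ x) +K (y *K σ y)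
    e = (x *K x) -K (y *K y)
    L-L′≡0 : L -K L′ ≡ 0K
    L-L′≡0 = trans (cong (λ u → L -K u) (sym L≡L′)) (x-K-x≡0K L)
    Le-dT≡0 : (L *K e) -K (d *K T) ≡ 0K
    Le-dT≡0 = begin
      (L *K e) -K (d *K T)
        ≡⟨ solve 5 (λ s x σx y σy →
             (((s :* (x :* x)) :+ (σx :* σx)) :* ((x :* x) :- (y :* y))) :- (((x :* σy) :- (σx :* y)) :* ((x :* σy) :+ (σx :* y)))
          := (x :* x) :* (((s :* (x :* x)) :+ (σx :* σx)) :- ((s :* (y :* y)) :+ (σy :* σy)))) refl s x (σ x) y (σ y) ⟩
      (x *K x) *K (L -K L′)  ≡⟨ cong ((x *K x) *K_) L-L′≡0 ⟩
      (x *K x) *K 0K         ≡⟨ *K-zeroʳ (x *K x) ⟩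
      0K                     ∎
    ce-dAB≡0 : (c *K e) -K (d *K AB) ≡ 0K
    ce-dAB≡0 = begin
      (c *K e) -K (d *K AB)
        ≡⟨ solve 5 (λ s x σx y σy →
             (((s :* (x :* y)) :+ (σx :* σy)) :* ((x :* x) :- (y :* y))) :- (((x :* σy) :- (σx :* y)) :* ((x :* σx) :+ (y :* σy)))
          := (x :* y) :* (((s :* (x :* x)) :+ (σx :* σx)) :- ((s :* (y :* y)) :+ (σy :* σy)))) refl s x (σ x) y (σ y) ⟩
      (x *K y) *K (L -K L′)  ≡⟨ cong ((x *K y) *K_) L-L′≡0 ⟩
      (x *K y) *K 0K         ≡⟨ *K-zeroʳ (x *K y) ⟩
      0K                     ∎
    key : ((c *K T) -K (L *K AB)) *K e ≡ 0K
    key = begin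
      ((c *K T) -K (L *K AB)) *K e
        ≡⟨ solve 6 (λ L c d T AB e → ((c :* T) :- (L :* AB)) :* e
                  := ((((c :* e) :- (d :* AB)) :* T) :- (((L :* e) :- (d :* T)) :* AB))) refl L c d T AB e ⟩
      (((c *K e) -K (d *K AB)) *K T) -K (((L *K e) -K (d *K T)) *K AB)
        ≡⟨ cong₂ (λ u v → (u *K T) -K (v *K AB)) ce-dAB≡0 Le-dT≡0 ⟩
      (0K *K T) -K (0K *K AB)
        ≡⟨ solve 2 (λ T AB → (con (+ 0) :* T) :- (con (+ 0) :* AB) := con (+ 0)) refl T AB ⟩
      0K ∎
    cT≡LAB : (c *K T) -K (L *K AB) ≡ 0K → c *K T ≡ L *K AB
    cT≡LAB = u-v≡0⇒u≡v
    e≡0⇒cT≡LAB : e ≡ 0K → c *K T ≡ L *K AB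
    e≡0⇒cT≡LAB e≡0 = begin
      c *K T   ≡⟨ cong (c *K_) (vanishes L T Le-dT≡0) ⟩
      c *K 0K  ≡⟨ *K-zeroʳ c ⟩
      0K       ≡⟨ *K-zeroʳ L ⟨
      L *K 0K  ≡⟨ cong (L *K_) (vanishes c AB ce-dAB≡0) ⟨
      L *K AB  ∎
      where
      vanishes : ∀ u v → (u *K e) -K (d *K v) ≡ 0K → v ≡ 0K
      vanishes u v ue-dv≡0 = [ (λ d≡0 → ⊥-elim (basis-det≢0K x∈O y∈O basis d≡0)) , (λ h → h) ]′ (K-integral d v (begin
        d *K v                              ≡⟨ solve 3 (λ d v w → d :* v := w :- (w :- (d :* v))) refl d v (u *K e) ⟩
        (u *K e) -K ((u *K e) -K (d *K v))  ≡⟨ cong₂ (λ w z → (u *K w) -K z) e≡0 ue-dv≡0 ⟩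
        (u *K 0K) -K 0K                     ≡⟨ solve 1 (λ u → (u :* con (+ 0)) :- con (+ 0) := con (+ 0)) refl u ⟩
        0K                                  ∎))

  good⇒sqN≢0 : ∀ {x y s} → InO x → InO y → IsZBasis x y → 0K <K s → GoodCond s x y → sqN s x ≢ 0K
  good⇒sqN≢0 {x} {y} {s} x∈O y∈O basis s>0 (L≡L′ , -L≤2c , 2c≤L) L≡0 = PosK-antisym 0K 0>0 0>0
    where
    -- L = 0 forces c = 0, and then s Δ = L L′ − c² = 0.
    open ≡-Reasoning
    open KSolver using (solve; _:+_; _:*_; _:-_; _:=_; :-_; con)
    c : K
    c = ip s x y
    2c≥0 : NonNegK (two *K c)
    2c≥0 = subst NonNegK (solve 1 (λ u → u :- (:- con (+ 0)) := u) refl (two *K c))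
                 (≤K⇒NonNegK (subst (λ u → (-K u) ≤K (two *K c)) L≡0 -L≤2c))
    -2c≥0 : NonNegK (-K (two *K c))
    -2c≥0 = subst NonNegK (solve 1 (λ u → con (+ 0) :- u := :- u) refl (two *K c))
                  (≤K⇒NonNegK (subst ((two *K c) ≤K_) L≡0 2c≤L))
    c≡0 : c ≡ 0K
    c≡0 = [ (λ ()) , (λ h → h) ]′ (emb-*K≡0 2ℚ c (NonNegK-antisym (two *K c) 2c≥0 -2c≥0))
    Δs≡0 : emb Δ *K s ≡ 0K
    Δs≡0 = begin
      emb Δ *K s                                          ≡⟨ cong (_*K s) (basis-det² x∈O y∈O basis) ⟨
      (det x y *K det x y) *K s
        ≡⟨ solve 5 (λ s x σx y σy → (((x :* σy) :- (σx :* y)) :* ((x :* σy) :- (σx :* y))) :* s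
             := (((s :* (x :* x)) :+ (σx :* σx)) :* ((s :* (y :* y)) :+ (σy :* σy)))
                :- (((s :* (x :* y)) :+ (σx :* σy)) :* ((s :* (x :* y)) :+ (σx :* σy))))
             refl s x (σ x) y (σ y) ⟩
      (sqN s x *K sqN s y) -K (c *K c)                    ≡⟨ cong₂ (λ u v → (u *K sqN s y) -K (v *K v)) L≡0 c≡0 ⟩
      (0K *K sqN s y) -K (0K *K 0K)
        ≡⟨ solve 1 (λ u → (con (+ 0) :* u) :- (con (+ 0) :* con (+ 0)) := con (+ 0)) refl (sqN s y) ⟩
      0K                                                  ∎
    s≡0 : s ≡ 0K
    s≡0 = [ (λ Δ≡0 → ⊥-elim (Δ≢0 Δ≡0)) , (λ h → h) ]′ (emb-*K≡0 Δ s Δs≡0)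
    0>0 : PosK 0K
    0>0 = subst (λ u → PosK (u -K 0K)) s≡0 s>0

  good⇒trace-bound : ∀ {x y t} s → InO x → InO y → IsZBasis x y → 0K <K s → GoodCond s x y → trace x y ≡ emb t →
                     4ℚ * ((N x + N y) * (N x + N y)) ≤ t * t
  good⇒trace-bound {x} {y} {t} s x∈O y∈O basis s>0 good@(L≡L′ , -L≤2c , 2c≤L) trace≡t =
    proportional⇒bound {sqN s x} {ip s x y} {N x + N y} {t}
      (good⇒sqN≢0 {x} {y} {s} x∈O y∈O basis s>0 good) ct≡L[Nx+Ny] -L≤2c 2c≤L
    where
    ct≡L[Nx+Ny] : ip s x y *K emb t ≡ sqN s x *K emb (N x + N y)
    ct≡L[Nx+Ny] = subst₂ (λ u v → ip s x y *K u ≡ sqN s x *K v) trace≡t (cong₂ _+K_ (*K-σ≡N x) (*K-σ≡N y))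
                    (good⇒proportional {x} {y} {s} x∈O y∈O basis L≡L′)

  trace≡emb : ∀ x y k → trace x y ≡ intK k *K (x *K σ x) → trace x y ≡ emb (fromℤ k * N x)
  trace≡emb x y k T≡kxσx = trans T≡kxσx (trans (cong (intK k *K_) (*K-σ≡N x)) (emb-* (fromℤ k) (N x)))

  good-bases⇒norm-product : ∀ {x y y′ r} → InO x → InO r → σ x ≡ x *K r → IsGood x y → IsGood x y′ →
                            N y * (N x + N y) ≡ N y′ * (N x + N y′)
  good-bases⇒norm-product {x} {y} {y′} x∈O r∈O σx≡xr
                          (_ , y∈O , basis , s , s>0 , good) (_ , y′∈O , basis′ , s′ , s′>0 , good′) =
    from-data (trace-multiple x∈O y∈O basis r∈O σx≡xr) (basis-change y∈O y′∈O basis basis′)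
    where
    from-data : (∃[ k ] trace x y ≡ intK k *K (x *K σ x)) → (∃[ m ] ∃[ n ] y′ ≡ lin m x n y × Unitℤ n) →
                N y * (N x + N y) ≡ N y′ * (N x + N y′)
    from-data (k , T≡kN) (m , n , y′≡mx+ny , n-unit) =
      norm-product-determined (N x) Δ (N y) (N y′) k k′ {m} {n} Nx≢0 n-unit refl
        (trace-square x∈O y∈O basis T≡) (trace-square x∈O y′∈O basis′ T′≡)
        (good⇒trace-bound s x∈O y∈O basis s>0 good T≡) (good⇒trace-bound s′ x∈O y′∈O basis′ s′>0 good′ T′≡)
      where
      k′ : ℤ
      k′ = + 2 ℤ.* m ℤ.+ n ℤ.* k
      Nx≢0 : N x ≢ 0ℚ
      Nx≢0 Nx≡0 = basis⇒≢0K basis (N≡0⇒≡0K x Nx≡0)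
      T≡ : trace x y ≡ emb (fromℤ k * N x)
      T≡ = trace≡emb x y k T≡kN
      T′≡ : trace x y′ ≡ emb (fromℤ k′ * N x)
      T′≡ = trace≡emb x y′ k′ (trans (cong (trace x) y′≡mx+ny) (trace-basis-change x y k m n T≡kN))

theorem4p2 : (D : ℕ) → 1 < D → SquareFree D →
    let open QF D in
    (x : K) → InO x →
    (N x * N x) ≤ (Δ * ((+ 1) / 3)) →
    (∀ z → (InσPrincipal x z → InPrincipal x z) × (InPrincipal x z → InσPrincipal x z)) →
    ∀ y y' → IsGood x y → IsGood x y' → F x y ≡ F x y'
theorem4p2 D 1<D sqf x x∈O _ σ-stable y y′ good good′ = from-ratio (proj₁ (σ-stable (σ x)) σx∈σ[x])
  where
  open QF D
  open QuadraticField D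
  open RealQuadraticField D 1<D sqf
  σx∈σ[x] : InσPrincipal x (σ x)
  σx∈σ[x] = x , (x∈O , 1K , 1∈O , sym (trans (*K-comm x 1K) (*K-identityˡ x))) , refl
  F≡ : ∀ a b c → a * a + a * b + b * b - c ≡ a * a + b * (a + b) - c
  F≡ = solve-∀ ℚ-ring
  from-ratio : InPrincipal x (σ x) → F x y ≡ F x y′
  from-ratio (_ , r , r∈O , σx≡xr) = begin
    F x y                                              ≡⟨ F≡ (N x) (N y) _ ⟩
    N x * N x + N y * (N x + N y) - Δ * ((+ 1) / 4)
      ≡⟨ cong (λ u → N x * N x + u - Δ * ((+ 1) / 4)) (good-bases⇒norm-product x∈O r∈O σx≡xr good good′) ⟩
    N x * N x + N y′ * (N x + N y′) - Δ * ((+ 1) / 4)  ≡⟨ F≡ (N x) (N y′) _ ⟨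
    F x y′                                             ∎
    where open ≡-Reasoning
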